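{- Let $k>1$ be an integer and let $x_1<x_2\le x$ be integers. Consider the following algorithm. Preprocessing: compute all primes up to $x^{1/k}$ (e.g. with the Atkin–Bernstein sieve) and the prefix-sum array $r[0]=0$, $r[j]=r[j-1]+p_j^k$. Main part: set $t_s\gets 1$, $\ell\gets\pi(x_2^{1/k})$; for $b=0,1,\dots,\ell$: while $t_s\le\ell$ and $t_s\le b$, increment $t_s$; while $t_s\le \ell$ and $r[t_s]-r[b]<x_1$, increment $t_s$; then for $t=t_s,t_s+1,\dots,\ell$: let $n=r[t]-r[b]$; if $x_1\le n<x_2$ output the pair $(n,p_{b+1})$; else if $n\ge x_2$ stop this loop over $t$. Then this algorithm lists all integers $n$ with $f_k(n)>0$ and $x_1\le n<x_2$, and the number of arithmetic operations it uses is $O\big(x^{1/k}/\log\log x+(s_k(x_2)-s_k(x_1))\big)$. Moreover, for every representation of such an $n$ as a sum of $k$th powers of consecutive primes, the first prime of that representation is also output.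
   Context: $p_j$ denotes the $j$th prime ($p_1=2$) and $\pi(y)$ the number of primes $\le y$. A positive integer $n$ is $k$-gleeful if $n=p_{b+1}^k+\cdots+p_t^k$ for some $0\le b<t$; $f_k(n)$ is the number of such representations of $n$, and $s_k(y)=\sum_{1\le n\le y}f_k(n)$. Here $k$ is regarded as fixed and $x$ as large; the $x^{1/k}/\log\log x$ term accounts for sieving the primes up to $x^{1/k}$. -}

module Defs where

open import Data.Nat using (ℕ; zero; suc; _+_; _*_; _∸_; _^_; _≤_; _<_; _≤ᵇ_; _<ᵇ_; _≤?_)
open import Data.Nat.Primality using (prime?)
open import Data.Nat.Logarithm using (⌊log₂_⌋)
open import Data.Nat using (_!)
open import Data.Bool using (Bool; true; false; if_then_else_; _∧_)
open import Data.List using (List; []; _∷_; length; filter; upTo)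
open import Data.Product using (_×_; _,_; Σ; ∃; ∃-syntax)
open import Relation.Nullary using (does)
open import Relation.Binary.PropositionalEquality using (_≡_)
open import Relation.Nullary.Decidable using (⌊_⌋)

firstPrimeFrom : ℕ → ℕ → ℕ
firstPrimeFrom zero    n = n
firstPrimeFrom (suc f) n = if does (prime? n) then n else firstPrimeFrom f (suc n)

-- smallest prime > m  (one exists in (m, m!+1], so fuel m! + 1 suffices)
nextPrime : ℕ → ℕ
nextPrime m = firstPrimeFrom (suc (m !)) (suc m)

-- p j = the j-th prime, 1-indexed: p 1 = 2, p 2 = 3, ...  (p 0 = 1 is a dummy value, never used)
p : ℕ → ℕ
p zero          = 1
p (suc zero)    = 2
p (suc (suc j)) = nextPrime (p (suc j))

π : ℕ → ℕ
π y = length (filter prime? (upTo (suc y)))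

-- iroot k x = ⌊ x^(1/k) ⌋ = largest m with m ^ k ≤ x (for k ≥ 1):
-- the m ∈ {0,…,x} with m ^ k ≤ x form the initial segment {0,…,⌊x^(1/k)⌋}
iroot : ℕ → ℕ → ℕ
iroot k x = length (filter (λ m → m ^ k ≤? x) (upTo (suc x))) ∸ 1

-- ⌊ log₂ ⌊ log₂ x ⌋ ⌋  (integer stand-in for log log x)
loglog : ℕ → ℕ
loglog x = ⌊log₂ ⌊log₂ x ⌋ ⌋

consec : ℕ → ℕ → ℕ → ℕ
consec k b zero    = 0
consec k b (suc m) = p (suc b) ^ k + consec k (suc b) m

S : ℕ → ℕ → ℕ → ℕ
S k b t = consec k b (t ∸ b)

Gleeful : ℕ → ℕ → Set
Gleeful k n = ∃[ b ] ∃[ t ] (b < t × S k b t ≡ n)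

-- f_k(n) = number of pairs (b,t), b < t, with S k b t = n.
-- Any such pair has t ≤ n (since p_t^k ≥ p_t > t), so counting b < t ≤ n is exhaustive.
pairsUpTo : ℕ → List (ℕ × ℕ)
pairsUpTo n = go (upTo (suc n))
  where
    inner : ℕ → List ℕ → List (ℕ × ℕ)
    inner t []       = []
    inner t (b ∷ bs) = (b , t) ∷ inner t bs
    cat : List (ℕ × ℕ) → List (ℕ × ℕ) → List (ℕ × ℕ)
    cat []       ys = ys
    cat (x ∷ xs) ys = x ∷ cat xs ys
    go : List ℕ → List (ℕ × ℕ)
    go []       = []
    go (t ∷ ts) = cat (inner t (upTo t)) (go ts)

f : ℕ → ℕ → ℕ
f k n = length (filter (λ bt → S k (Data.Product.proj₁ bt) (Data.Product.proj₂ bt) Data.Nat.≟ n) (pairsUpTo n))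

s : ℕ → ℕ → ℕ
s k zero    = 0
s k (suc y) = s k y + f k (suc y)

-- Cost model: one unit per loop-condition test / loop-body execution
-- (each of which performs O(1) arithmetic operations, k being fixed),
-- plus k units per prefix sum entry r[j] = r[j-1] + p_j^k,
-- plus the cost of the sieve (an abstract function of the sieve bound).

r : ℕ → ℕ → ℕ
r k zero    = 0
r k (suc t) = r k t + p (suc t) ^ k

-- generic while loop: "while c ts do ts ← ts + 1", fuel-bounded;
-- returns (final ts , number of condition tests)
while : ℕ → (ℕ → Bool) → ℕ → ℕ × ℕ
while zero    c ts = ts , 1
while (suc g) c ts with c ts
... | false = ts , 1
... | true  with while g c (suc ts)
...   | ts' , n = ts' , suc n

module Algorithm (k x1 x2 : ℕ) where

  ℓ : ℕ
  ℓ = π (iroot k x2)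

  rr : ℕ → ℕ
  rr = r k

  tLoop : ℕ → ℕ → ℕ → List (ℕ × ℕ) × ℕ
  tLoop zero    b t = [] , 1
  tLoop (suc g) b t with t ≤ᵇ ℓ
  ... | false = [] , 1
  ... | true with (x1 ≤ᵇ (rr t ∸ rr b)) ∧ ((rr t ∸ rr b) <ᵇ x2)
  ...   | true with tLoop g b (suc t)
  ...     | out , c = ((rr t ∸ rr b) , p (suc b)) ∷ out , suc c
  tLoop (suc g) b t | true | false with x2 ≤ᵇ (rr t ∸ rr b)
  ...     | true = [] , 1
  ...     | false with tLoop g b (suc t)
  ...       | out , c = out , suc c

  cat : List (ℕ × ℕ) → List (ℕ × ℕ) → List (ℕ × ℕ)
  cat []       ys = ys
  cat (x ∷ xs) ys = x ∷ cat xs ys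

  -- one iteration of the loop over b, given the current t_s
  -- returns (new t_s , outputs , cost)
  bStep : ℕ → ℕ → ℕ × List (ℕ × ℕ) × ℕ
  bStep b ts with while (suc ℓ) (λ t → (t ≤ᵇ ℓ) ∧ (t ≤ᵇ b)) ts
  ... | ts1 , c1 with while (suc ℓ) (λ t → (t ≤ᵇ ℓ) ∧ ((rr t ∸ rr b) <ᵇ x1)) ts1
  ...   | ts2 , c2 with tLoop (suc ℓ) b ts2
  ...     | out , c3 = ts2 , out , c1 + c2 + c3

  bLoop : ℕ → ℕ → ℕ → List (ℕ × ℕ) × ℕ
  bLoop zero    b ts = [] , 1
  bLoop (suc g) b ts with bStep b ts
  ... | ts' , out , c with bLoop g (suc b) ts'
  ...   | out' , c' = cat out out' , suc (c + c')

  mainPart : List (ℕ × ℕ) × ℕ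
  mainPart = bLoop (suc ℓ) 0 1

  output : List (ℕ × ℕ)
  output = Data.Product.proj₁ mainPart

  mainCost : ℕ
  mainCost = Data.Product.proj₂ mainPart

totalCost : (ℕ → ℕ) → ℕ → ℕ → ℕ → ℕ → ℕ
totalCost sieveCost k x x1 x2 =
  sieveCost (iroot k x) + π (iroot k x) * k + Algorithm.mainCost k x1 x2

-- hypothesis on the sieve (Atkin–Bernstein): O(N / log log N) operations
SieveBound : (ℕ → ℕ) → Set
SieveBound sieveCost = ∃[ A ] ∃[ N₀ ] (∀ N → N₀ ≤ N → sieveCost N * loglog N ≤ A * N)

-- S k b t = p_{b+1}^k + ... + p_t^k increases in t and decreases in b.
-- Hence the pointer t_s only ever skips pairs (b, t) with S k b t < x1, so for each b
-- the inner loop starts at the first t with x1 ≤ S k b t and lists exactly the t with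
-- S k b t < x2; and any representation with sum below x2 has p_t ≤ x2^{1/k}, i.e. t ≤ ℓ.
--
-- Every test of the two while loops advances t_s ≤ ℓ + 1, and every inner
-- iteration but the last outputs a pair, so the main part costs O(ℓ + #output).  Output
-- pairs with sum in (x1, x2] are counted by s_k(x2) - s_k(x1); sums equal to x1 occur at
-- most once per b.  The prefix sums cost k π(x^{1/k}), and π(N) log log N = O(N) by a
-- Chebyshev-type argument: for y = 2^⌊log₂ ⌊log₂ N⌋⌋ the primes in (y, N] are at least y
-- while their product is at most 8^N.  Finally log log x ≤ (k + 2) log log x^{1/k}.
module Submission where

open import Defs
open import Data.Nat using (ℕ; _+_; _*_; _∸_; _≤_; _<_)
open import Data.Product using (_×_; _,_; ∃-syntax; proj₁)
open import Data.List using (map)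
open import Data.List.Membership.Propositional using (_∈_)
open import Function.Bundles using (_⇔_)

open import Data.Bool using (Bool; true; false; _∧_; if_then_else_)
open import Data.Empty using (⊥; ⊥-elim)
open import Data.List using (List; []; _∷_; _++_; filter; length; upTo; applyUpTo)
open import Data.List.Membership.Propositional.Properties
  using (∈-++⁺ˡ; ∈-++⁺ʳ; ∈-++⁻; ∈-map⁺; ∈-map⁻; ∈-upTo⁺; ∈-upTo⁻; ∈-filter⁺; ∈-filter⁻; ∈-length)
open import Data.List.Properties using (map-++; map-∘; upTo-∷ʳ; length-++)
open import Data.List.Relation.Unary.All using (_∷_)
open import Data.List.Relation.Unary.Any using (here; there)
open import Data.Nat
open import Data.Nat.Combinatorics using (_C_; nCk≡n!/k![n-k]!; k![n∸k]!∣n!; nCk+nC[k+1]≡[n+1]C[k+1])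
open import Data.Nat.Divisibility using (_∣_; divides; ∣⇒≤; ∣1⇒≡1; ∣-trans; 1∣_; ∣m+n∣m⇒∣n; m∣m*n; m≤n⇒m!∣n!)
open import Data.Nat.DivMod using (m/n*n≡m)
open import Data.Nat.Induction using (<-rec; <-wellFounded)
open import Data.Nat.ListAction using (sum; product)
open import Data.Nat.ListAction.Properties using (sum-++)
open import Data.Nat.Logarithm using (⌊log₂_⌋; ⌊log₂⌋-mono-≤; ⌊log₂[2^n]⌋≡n)
open import Data.Nat.Logarithm.Core using (⌊log2⌋)
open import Data.Nat.Primality using (Prime; prime?; prime[2]; prime⇒nonZero; prime⇒nonTrivial; euclidsLemma)
open import Data.Nat.Primality.Factorisation using (factorise)
open import Data.Nat.Properties
open import Data.Nat.Solver using (module +-*-Solver)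
open import Data.Product using (proj₂)
open import Data.Sum using (_⊎_; inj₁; inj₂; [_,_])
open import Function using (_∘_; id)
open import Function.Bundles using (mk⇔; Equivalence)
open import Induction.WellFounded using (Acc; acc)
open import Relation.Binary.Definitions using (tri<; tri≈; tri>)
open import Relation.Binary.PropositionalEquality using (_≡_; refl; sym; trans; cong; cong₂; subst; module ≡-Reasoning)
open import Relation.Nullary using (Dec; yes; no; does; ¬_)
open import Relation.Nullary.Decidable using (_×-dec_)
open import Relation.Nullary.Reflects using (Reflects; ofʸ; ofⁿ; _×-reflects_)
open import Relation.Unary using (Decidable)

open import Algebra.Properties.CommutativeSemigroup +-commutativeSemigroup
  using () renaming (interchange to +-interchange)

-- Indicators and finite sums

𝟙 : {P : Set} → Dec P → ℕ
𝟙 P? = if does P? then 1 else 0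

𝟙-yes : {P : Set} (P? : Dec P) → P → 𝟙 P? ≡ 1
𝟙-yes (yes _) _ = refl
𝟙-yes (no ¬P) P = ⊥-elim (¬P P)

𝟙-no : {P : Set} (P? : Dec P) → ¬ P → 𝟙 P? ≡ 0
𝟙-no (yes P) ¬P = ⊥-elim (¬P P)
𝟙-no (no _) _ = refl

𝟙≤1 : {P : Set} (P? : Dec P) → 𝟙 P? ≤ 1
𝟙≤1 (yes _) = ≤-refl
𝟙≤1 (no _) = z≤n

𝟙-mono : {P Q : Set} (P? : Dec P) (Q? : Dec Q) → (P → Q) → 𝟙 P? ≤ 𝟙 Q?
𝟙-mono P? (yes _) _ = 𝟙≤1 P?
𝟙-mono (yes P) (no ¬Q) P⇒Q = ⊥-elim (¬Q (P⇒Q P))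
𝟙-mono (no _) (no _) _ = z≤n

𝟙-cong : {P Q : Set} (P? : Dec P) (Q? : Dec Q) → (P → Q) → (Q → P) → 𝟙 P? ≡ 𝟙 Q?
𝟙-cong P? Q? P⇒Q Q⇒P = ≤-antisym (𝟙-mono P? Q? P⇒Q) (𝟙-mono Q? P? Q⇒P)

𝟙-⊎ : {P Q R : Set} (P? : Dec P) (Q? : Dec Q) (R? : Dec R) →
      (P ⊎ Q → R) → (R → P ⊎ Q) → (P → Q → ⊥) → 𝟙 P? + 𝟙 Q? ≡ 𝟙 R?
𝟙-⊎ (yes P) (yes Q) R? _ _ disjoint = ⊥-elim (disjoint P Q)
𝟙-⊎ (yes P) (no _) R? to _ _ = sym (𝟙-yes R? (to (inj₁ P)))
𝟙-⊎ (no _) (yes Q) R? to _ _ = sym (𝟙-yes R? (to (inj₂ Q)))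
𝟙-⊎ (no ¬P) (no ¬Q) R? _ from _ = sym (𝟙-no R? ([ ¬P , ¬Q ] ∘ from))

𝟙-≤-⊎ : {P Q R : Set} (P? : Dec P) (Q? : Dec Q) (R? : Dec R) → (R → P ⊎ Q) → 𝟙 R? ≤ 𝟙 P? + 𝟙 Q?
𝟙-≤-⊎ P? Q? (no _) _ = z≤n
𝟙-≤-⊎ P? Q? (yes R) from with from R
... | inj₁ P = ≤-trans (≤-reflexive (sym (𝟙-yes P? P))) (m≤m+n (𝟙 P?) (𝟙 Q?))
... | inj₂ Q = ≤-trans (≤-reflexive (sym (𝟙-yes Q? Q))) (m≤n+m (𝟙 Q?) (𝟙 P?))

length-filter≡sum-𝟙 : {A : Set} {P : A → Set} (P? : Decidable P) (xs : List A) →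
                      length (filter P? xs) ≡ sum (map (𝟙 ∘ P?) xs)
length-filter≡sum-𝟙 P? [] = refl
length-filter≡sum-𝟙 P? (x ∷ xs) with P? x
... | yes _ = cong suc (length-filter≡sum-𝟙 P? xs)
... | no _ = length-filter≡sum-𝟙 P? xs

∑< : ℕ → (ℕ → ℕ) → ℕ
∑< n g = sum (map g (upTo n))

syntax ∑< n (λ i → e) = ∑[ i < n ] e

∑-suc : ∀ n g → ∑< (suc n) g ≡ ∑< n g + g n
∑-suc n g = begin
  sum (map g (upTo (suc n)))      ≡⟨ cong (sum ∘ map g) (upTo-∷ʳ n) ⟨
  sum (map g (upTo n ++ (n ∷ [])))   ≡⟨ cong sum (map-++ g (upTo n) (n ∷ [])) ⟩
  sum (map g (upTo n) ++ (g n ∷ [])) ≡⟨ sum-++ (map g (upTo n)) (g n ∷ []) ⟩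
  ∑< n g + (g n + 0)              ≡⟨ cong (∑< n g +_) (+-identityʳ (g n)) ⟩
  ∑< n g + g n                    ∎
  where open ≡-Reasoning

∑-mono-≤ : ∀ n {g h} → (∀ i → i < n → g i ≤ h i) → ∑< n g ≤ ∑< n h
∑-mono-≤ zero _ = z≤n
∑-mono-≤ (suc n) {g} {h} g≤h rewrite ∑-suc n g | ∑-suc n h =
  +-mono-≤ (∑-mono-≤ n (λ i i<n → g≤h i (m<n⇒m<1+n i<n))) (g≤h n ≤-refl)

∑-cong : ∀ n {g h} → (∀ i → i < n → g i ≡ h i) → ∑< n g ≡ ∑< n h
∑-cong n g≡h = ≤-antisym (∑-mono-≤ n (λ i i<n → ≤-reflexive (g≡h i i<n)))
                         (∑-mono-≤ n (λ i i<n → ≤-reflexive (sym (g≡h i i<n))))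

∑-+ : ∀ n g h → ∑[ i < n ] (g i + h i) ≡ ∑< n g + ∑< n h
∑-+ zero g h = refl
∑-+ (suc n) g h rewrite ∑-suc n (λ i → g i + h i) | ∑-suc n g | ∑-suc n h | ∑-+ n g h =
  +-interchange (∑< n g) (∑< n h) (g n) (h n)

∑-vanish : ∀ n {g} → (∀ i → i < n → g i ≡ 0) → ∑< n g ≡ 0
∑-vanish zero _ = refl
∑-vanish (suc n) {g} g≡0
  rewrite ∑-suc n g | g≡0 n ≤-refl | ∑-vanish n (λ i i<n → g≡0 i (m<n⇒m<1+n i<n)) = refl

∑-≤-extend : ∀ {n m} g → n ≤ m → ∑< n g ≤ ∑< m g
∑-≤-extend {m = zero} g z≤n = z≤n
∑-≤-extend {n} {suc m} g n≤1+m with m≤n⇒m<n∨m≡n n≤1+m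
... | inj₂ refl = ≤-refl
... | inj₁ n<1+m rewrite ∑-suc m g = ≤-trans (∑-≤-extend g (s≤s⁻¹ n<1+m)) (m≤m+n (∑< m g) (g m))

∑-extend : ∀ {n m} g → n ≤ m → (∀ i → n ≤ i → i < m → g i ≡ 0) → ∑< m g ≡ ∑< n g
∑-extend {m = zero} g z≤n _ = refl
∑-extend {n} {suc m} g n≤1+m g≡0 with m≤n⇒m<n∨m≡n n≤1+m
... | inj₂ refl = refl
... | inj₁ n<1+m rewrite ∑-suc m g | g≡0 m (s≤s⁻¹ n<1+m) ≤-refl | +-identityʳ (∑< m g) =
  ∑-extend g (s≤s⁻¹ n<1+m) (λ i n≤i i<m → g≡0 i n≤i (m<n⇒m<1+n i<m))

∑-swap : ∀ m n (h : ℕ → ℕ → ℕ) → ∑[ i < m ] ∑[ j < n ] h i j ≡ ∑[ j < n ] ∑[ i < m ] h i j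
∑-swap zero n h = sym (∑-vanish n (λ _ _ → refl))
∑-swap (suc m) n h = begin
  ∑[ i < suc m ] ∑[ j < n ] h i j                  ≡⟨ ∑-suc m (λ i → ∑[ j < n ] h i j) ⟩
  ∑[ i < m ] ∑[ j < n ] h i j + ∑[ j < n ] h m j   ≡⟨ cong (_+ ∑[ j < n ] h m j) (∑-swap m n h) ⟩
  ∑[ j < n ] ∑[ i < m ] h i j + ∑[ j < n ] h m j   ≡⟨ ∑-+ n (λ j → ∑[ i < m ] h i j) (λ j → h m j) ⟨
  ∑[ j < n ] (∑[ i < m ] h i j + h m j)            ≡⟨ ∑-cong n (λ j _ → ∑-suc m (λ i → h i j)) ⟨
  ∑[ j < n ] ∑[ i < suc m ] h i j                  ∎
  where open ≡-Reasoning

∑-≤-* : ∀ n {g} c → (∀ i → i < n → g i ≤ c) → ∑< n g ≤ n * c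
∑-≤-* zero c _ = z≤n
∑-≤-* (suc n) {g} c g≤c rewrite ∑-suc n g | +-comm c (n * c) =
  +-mono-≤ (∑-≤-* n c (λ i i<n → g≤c i (m<n⇒m<1+n i<n))) (g≤c n ≤-refl)

∑-𝟙-≤1 : ∀ n {P : ℕ → Set} (P? : Decidable P) → (∀ {i j} → P i → P j → i ≡ j) →
         ∑[ i < n ] 𝟙 (P? i) ≤ 1
∑-𝟙-≤1 zero P? unique = z≤n
∑-𝟙-≤1 (suc n) P? unique rewrite ∑-suc n (𝟙 ∘ P?) with P? n
... | no _ rewrite +-identityʳ (∑[ i < n ] 𝟙 (P? i)) = ∑-𝟙-≤1 n P? unique
... | yes Pn rewrite ∑-vanish n (λ i i<n → 𝟙-no (P? i) (λ Pi → <⇒≢ i<n (unique Pi Pn))) = ≤-refl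

countPairs : {P : ℕ → ℕ → Set} → (∀ i j → Dec (P i j)) → ℕ → ℕ
countPairs P? m = ∑[ i < m ] ∑[ j < m ] 𝟙 (P? i j)

module _ {P Q : ℕ → ℕ → Set} (P? : ∀ i j → Dec (P i j)) (Q? : ∀ i j → Dec (Q i j)) where

  private
    countPairs-+ : ∀ m → countPairs P? m + countPairs Q? m ≡ ∑[ i < m ] ∑[ j < m ] (𝟙 (P? i j) + 𝟙 (Q? i j))
    countPairs-+ m = trans (sym (∑-+ m (λ i → ∑[ j < m ] 𝟙 (P? i j)) (λ i → ∑[ j < m ] 𝟙 (Q? i j))))
                           (∑-cong m (λ i _ → sym (∑-+ m (λ j → 𝟙 (P? i j)) (λ j → 𝟙 (Q? i j)))))

  countPairs-⊎ : ∀ {R : ℕ → ℕ → Set} (R? : ∀ i j → Dec (R i j)) m →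
                 (∀ {i j} → P i j ⊎ Q i j → R i j) → (∀ {i j} → R i j → P i j ⊎ Q i j) →
                 (∀ {i j} → P i j → Q i j → ⊥) →
                 countPairs P? m + countPairs Q? m ≡ countPairs R? m
  countPairs-⊎ R? m to from disjoint = trans (countPairs-+ m)
    (∑-cong m (λ i _ → ∑-cong m (λ j _ → 𝟙-⊎ (P? i j) (Q? i j) (R? i j) to from disjoint)))

  countPairs-≤-⊎ : ∀ {R : ℕ → ℕ → Set} (R? : ∀ i j → Dec (R i j)) m →
                   (∀ {i j} → R i j → P i j ⊎ Q i j) → countPairs R? m ≤ countPairs P? m + countPairs Q? m
  countPairs-≤-⊎ R? m from = ≤-trans
    (∑-mono-≤ m (λ i _ → ∑-mono-≤ m (λ j _ → 𝟙-≤-⊎ (P? i j) (Q? i j) (R? i j) from)))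
    (≤-reflexive (sym (countPairs-+ m)))

countPairs-≤-extend : ∀ {P : ℕ → ℕ → Set} (P? : ∀ i j → Dec (P i j)) {n m} → n ≤ m →
                      countPairs P? n ≤ countPairs P? m
countPairs-≤-extend P? {n} {m} n≤m = ≤-trans
  (∑-mono-≤ n (λ i _ → ∑-≤-extend (λ j → 𝟙 (P? i j)) n≤m))
  (∑-≤-extend (λ i → ∑[ j < m ] 𝟙 (P? i j)) n≤m)

-- Primes

prime⇒≥2 : ∀ {q} → Prime q → 2 ≤ q
prime⇒≥2 {q} q-prime = nonTrivial⇒n>1 q {{prime⇒nonTrivial q-prime}}

∃-prime-factor : ∀ n → 2 ≤ n → ∃[ q ] Prime q × q ∣ n
∃-prime-factor n@(suc _) 2≤n with factorise n
... | record { factors = [] ; isFactorisation = n≡1 } = ⊥-elim (<⇒≢ 2≤n (sym n≡1))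
... | record { factors = q ∷ qs ; isFactorisation = n≡q*qs ; factorsPrime = q-prime ∷ _ } =
  q , q-prime , subst (q ∣_) (sym n≡q*qs) (m∣m*n (product qs))

n∣n! : ∀ n → .{{NonZero n}} → n ∣ n !
n∣n! (suc n) = m∣m*n (n !)

firstPrimeFrom-≥ : ∀ fuel n → n ≤ firstPrimeFrom fuel n
firstPrimeFrom-≥ zero n = ≤-refl
firstPrimeFrom-≥ (suc fuel) n with prime? n
... | yes _ = ≤-refl
... | no _ = ≤-trans (n≤1+n n) (firstPrimeFrom-≥ fuel (suc n))

firstPrimeFrom-prime : ∀ fuel n {q} → Prime q → n ≤ q → q < n + fuel → Prime (firstPrimeFrom fuel n)
firstPrimeFrom-prime zero n _ n≤q q<n+0 = ⊥-elim (<⇒≱ (subst (_ <_) (+-identityʳ n) q<n+0) n≤q)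
firstPrimeFrom-prime (suc fuel) n {q} q-prime n≤q q<n+1+fuel with prime? n | m≤n⇒m<n∨m≡n n≤q
... | yes n-prime | _ = n-prime
... | no ¬n-prime | inj₂ refl = ⊥-elim (¬n-prime q-prime)
... | no _ | inj₁ n<q = firstPrimeFrom-prime fuel (suc n) q-prime n<q (subst (q <_) (+-suc n fuel) q<n+1+fuel)

-- Euclid: a prime factor of m ! + 1 lies in (m, m ! + 1], the range searched by nextPrime m.
nextPrime-prime : ∀ m → Prime (nextPrime m)
nextPrime-prime m with ∃-prime-factor (m ! + 1) (+-monoˡ-≤ 1 (1≤n! m))
... | q , q-prime , q∣m!+1 = firstPrimeFrom-prime (suc (m !)) (suc m) q-prime m<q q<1+m+1+m!
  where
  q≤m!+1 : q ≤ m ! + 1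
  q≤m!+1 = ∣⇒≤ {{subst NonZero (+-comm 1 (m !)) _}} q∣m!+1
  m<q : m < q
  m<q = ≰⇒> λ q≤m → <⇒≢ (prime⇒≥2 q-prime)
    (sym (∣1⇒≡1 (∣m+n∣m⇒∣n q∣m!+1 (∣-trans (n∣n! q {{prime⇒nonZero q-prime}}) (m≤n⇒m!∣n! q≤m)))))
  q<1+m+1+m! : q < suc m + suc (m !)
  q<1+m+1+m! = s≤s (≤-trans q≤m!+1 (≤-trans (≤-reflexive (+-comm (m !) 1)) (m≤n+m (suc (m !)) m)))

p-prime : ∀ j → Prime (p (suc j))
p-prime zero = prime[2]
p-prime (suc j) = nextPrime-prime (p (suc j))

p[j]<p[1+j] : ∀ j → p j < p (suc j)
p[j]<p[1+j] zero = s≤s (s≤s z≤n)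
p[j]<p[1+j] (suc j) = firstPrimeFrom-≥ (suc (p (suc j) !)) (suc (p (suc j)))

j<p[j] : ∀ j → j < p j
j<p[j] zero = s≤s z≤n
j<p[j] (suc j) = ≤-trans (s≤s (j<p[j] j)) (p[j]<p[1+j] j)

π-suc : ∀ y → π (suc y) ≡ π y + 𝟙 (prime? (suc y))
π-suc y = begin
  π (suc y)                                          ≡⟨ length-filter≡sum-𝟙 prime? (upTo (2 + y)) ⟩
  ∑[ i < suc (suc y) ] 𝟙 (prime? i)                  ≡⟨ ∑-suc (suc y) (𝟙 ∘ prime?) ⟩
  ∑[ i < suc y ] 𝟙 (prime? i) + 𝟙 (prime? (suc y))   ≡⟨ cong (_+ 𝟙 (prime? (suc y))) πy≡∑ ⟨
  π y + 𝟙 (prime? (suc y))                           ∎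
  where
  open ≡-Reasoning
  πy≡∑ : π y ≡ ∑[ i < suc y ] 𝟙 (prime? i)
  πy≡∑ = length-filter≡sum-𝟙 prime? (upTo (suc y))

π≤ : ∀ y → π y ≤ y
π≤ zero = z≤n
π≤ (suc y) rewrite π-suc y | +-comm (π y) (𝟙 (prime? (suc y))) = +-mono-≤ (𝟙≤1 (prime? (suc y))) (π≤ y)

π-mono-≤ : ∀ {y z} → y ≤ z → π y ≤ π z
π-mono-≤ {y} {zero} z≤n = ≤-refl
π-mono-≤ {y} {suc z} y≤1+z with m≤n⇒m<n∨m≡n y≤1+z
... | inj₂ refl = ≤-refl
... | inj₁ y<1+z rewrite π-suc z = ≤-trans (π-mono-≤ (s≤s⁻¹ y<1+z)) (m≤m+n (π z) _)

π-mono-<-prime : ∀ {y z} → y < z → Prime z → π y < π z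
π-mono-<-prime {y} {suc z} y<1+z z-prime rewrite π-suc z | 𝟙-yes (prime? (suc z)) z-prime | +-comm (π z) 1 =
  s≤s (π-mono-≤ (s≤s⁻¹ y<1+z))

j≤π[p[j]] : ∀ j → j ≤ π (p j)
j≤π[p[j]] zero = z≤n
j≤π[p[j]] (suc j) = ≤-trans (s≤s (j≤π[p[j]] j)) (π-mono-<-prime (p[j]<p[1+j] j) (p-prime j))

-- Integer k-th roots

module InitialSegment {Q : ℕ → Set} (Q? : Decidable Q) (Q-down : ∀ {i j} → i ≤ j → Q j → Q i) where

  count : ℕ → ℕ
  count n = ∑[ i < n ] 𝟙 (Q? i)

  count≤ : ∀ n → count n ≤ n
  count≤ n = ≤-trans (∑-≤-* n 1 (λ i _ → 𝟙≤1 (Q? i))) (≤-reflexive (*-identityʳ n))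

  count-full : ∀ n → (∀ i → i < n → Q i) → count n ≡ n
  count-full zero _ = refl
  count-full (suc n) Q<1+n rewrite ∑-suc n (𝟙 ∘ Q?) | 𝟙-yes (Q? n) (Q<1+n n ≤-refl)
    | count-full n (λ i i<n → Q<1+n i (m<n⇒m<1+n i<n)) = +-comm n 1

  <count⇔ : ∀ n {i} → i < n → Q i ⇔ i < count n
  <count⇔ (suc n) {i} i<1+n rewrite ∑-suc n (𝟙 ∘ Q?) with Q? n
  ... | yes Qn rewrite count-full n (λ j j<n → Q-down (<⇒≤ j<n) Qn) | +-comm n 1 =
    mk⇔ (λ _ → i<1+n) (λ _ → Q-down (s≤s⁻¹ i<1+n) Qn)
  ... | no ¬Qn rewrite +-identityʳ (count n) with m≤n⇒m<n∨m≡n (s≤s⁻¹ i<1+n)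
  ...   | inj₁ i<n = <count⇔ n i<n
  ...   | inj₂ refl = mk⇔ (λ Qn → ⊥-elim (¬Qn Qn)) (λ n<count → ⊥-elim (<⇒≱ n<count (count≤ n)))

n≤n^k : ∀ n {k} → 1 ≤ k → n ≤ n ^ k
n≤n^k zero _ = z≤n
n≤n^k (suc n) {suc k} _ = m≤m*n (suc n) (suc n ^ k) {{>-nonZero (m^n>0 (suc n) k)}}

0^n≡0 : ∀ {n} → 1 ≤ n → 0 ^ n ≡ 0
0^n≡0 {suc n} _ = refl

module _ {k : ℕ} (k≥1 : 1 ≤ k) where

  private
    module Powers≤ (x : ℕ) =
      InitialSegment (λ m → m ^ k ≤? x) (λ i≤j j^k≤x → ≤-trans (^-monoˡ-≤ k i≤j) j^k≤x)

    0^k≤x : ∀ x → 0 ^ k ≤ x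
    0^k≤x x = subst (_≤ x) (sym (0^n≡0 k≥1)) z≤n

    1+iroot≡count : ∀ x → suc (iroot k x) ≡ Powers≤.count x (suc x)
    1+iroot≡count x =
      trans (cong (λ c → suc (c ∸ 1)) (length-filter≡sum-𝟙 (λ m → m ^ k ≤? x) (upTo (suc x))))
            (m+[n∸m]≡n (Equivalence.to (Powers≤.<count⇔ x (suc x) (s≤s z≤n)) (0^k≤x x)))

    iroot≤ : ∀ x → iroot k x ≤ x
    iroot≤ x = s≤s⁻¹ (subst (_≤ suc x) (sym (1+iroot≡count x)) (Powers≤.count≤ x (suc x)))

  ^≤⇔≤iroot : ∀ {x m} → m ^ k ≤ x ⇔ m ≤ iroot k x
  ^≤⇔≤iroot {x} {m} with m <? suc x
  ... | yes m<1+x = mk⇔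
    (λ m^k≤x → s≤s⁻¹ (subst (m <_) (sym (1+iroot≡count x)) (Equivalence.to segment m^k≤x)))
    (λ m≤iroot → Equivalence.from segment (subst (m <_) (1+iroot≡count x) (s≤s m≤iroot)))
    where
    segment : m ^ k ≤ x ⇔ m < Powers≤.count x (suc x)
    segment = Powers≤.<count⇔ x (suc x) m<1+x
  ... | no m≮1+x = mk⇔
    (λ m^k≤x → ⊥-elim (m≮1+x (s≤s (≤-trans (n≤n^k m k≥1) m^k≤x))))
    (λ m≤iroot → ⊥-elim (m≮1+x (s≤s (≤-trans m≤iroot (iroot≤ x)))))

  iroot-^≤ : ∀ x → iroot k x ^ k ≤ x
  iroot-^≤ x = Equivalence.from ^≤⇔≤iroot ≤-refl

  <[1+iroot]^ : ∀ x → x < suc (iroot k x) ^ k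
  <[1+iroot]^ x = ≰⇒> (λ 1+iroot^k≤x → 1+n≰n (Equivalence.to ^≤⇔≤iroot 1+iroot^k≤x))

  iroot-mono-≤ : ∀ {x y} → x ≤ y → iroot k x ≤ iroot k y
  iroot-mono-≤ {x} x≤y = Equivalence.to ^≤⇔≤iroot (≤-trans (iroot-^≤ x) x≤y)

-- Sums of k-th powers of consecutive primes

module _ (k : ℕ) where

  consec-suc : ∀ b m → consec k b (suc m) ≡ consec k b m + p (suc (b + m)) ^ k
  consec-suc b zero rewrite +-identityʳ b = +-comm (p (suc b) ^ k) 0
  consec-suc b (suc m) rewrite consec-suc (suc b) m | +-suc b m =
    sym (+-assoc (p (suc b) ^ k) (consec k (suc b) m) _)

  r-+ : ∀ b m → r k (b + m) ≡ r k b + consec k b m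
  r-+ b zero rewrite +-identityʳ b = sym (+-identityʳ (r k b))
  r-+ b (suc m) rewrite +-suc b m | r-+ b m | consec-suc b m =
    +-assoc (r k b) (consec k b m) _

  r∸r≡S : ∀ {b t} → b ≤ t → r k t ∸ r k b ≡ S k b t
  r∸r≡S {b} {t} b≤t = begin
    r k t ∸ r k b                    ≡⟨ cong (λ u → r k u ∸ r k b) (m+[n∸m]≡n b≤t) ⟨
    r k (b + (t ∸ b)) ∸ r k b        ≡⟨ cong (_∸ r k b) (r-+ b (t ∸ b)) ⟩
    r k b + S k b t ∸ r k b          ≡⟨ m+n∸m≡n (r k b) (S k b t) ⟩
    S k b t                          ∎
    where open ≡-Reasoning

  S-suc : ∀ {b t} → b ≤ t → S k b (suc t) ≡ S k b t + p (suc t) ^ k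
  S-suc {b} {t} b≤t rewrite +-∸-assoc 1 b≤t | consec-suc b (t ∸ b) | m+[n∸m]≡n b≤t = refl

  S-first : ∀ {b t} → b < t → S k b t ≡ p (suc b) ^ k + S k (suc b) t
  S-first {b} {suc t} b<1+t rewrite +-∸-assoc 1 (s≤s⁻¹ b<1+t) = refl

  p^k>0 : ∀ j → 0 < p (suc j) ^ k
  p^k>0 j = m^n>0 (p (suc j)) {{>-nonZero (<-trans z<s (j<p[j] (suc j)))}} k

  S-monoʳ-< : ∀ {b t u} → b ≤ t → t < u → S k b t < S k b u
  S-monoʳ-< {b} {t} {suc u} b≤t t<1+u with m≤n⇒m<n∨m≡n (s≤s⁻¹ t<1+u)
  ... | inj₂ refl rewrite S-suc b≤t = m<m+n (S k b t) (p^k>0 t)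
  ... | inj₁ t<u rewrite S-suc (≤-trans b≤t (<⇒≤ t<u)) = ≤-trans (S-monoʳ-< b≤t t<u) (m≤m+n _ _)

  S-injectiveʳ : ∀ {b t u} → b < t → b < u → S k b t ≡ S k b u → t ≡ u
  S-injectiveʳ {t = t} {u} b<t b<u St≡Su with <-cmp t u
  ... | tri< t<u _ _ = ⊥-elim (<⇒≢ (S-monoʳ-< (<⇒≤ b<t) t<u) St≡Su)
  ... | tri≈ _ t≡u _ = t≡u
  ... | tri> _ _ u<t = ⊥-elim (<⇒≢ (S-monoʳ-< (<⇒≤ b<u) u<t) (sym St≡Su))

  S-monoʳ-≤ : ∀ {b t u} → b ≤ t → t ≤ u → S k b t ≤ S k b u
  S-monoʳ-≤ b≤t t≤u with m≤n⇒m<n∨m≡n t≤u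
  ... | inj₂ refl = ≤-refl
  ... | inj₁ t<u = <⇒≤ (S-monoʳ-< b≤t t<u)

  S-antimonoˡ : ∀ {b t} → b < t → S k (suc b) t ≤ S k b t
  S-antimonoˡ b<t rewrite S-first b<t = m≤n+m _ _

  p^k≤S : ∀ {b t} → b < t → p t ^ k ≤ S k b t
  p^k≤S {b} {suc t} b<1+t rewrite S-suc (s≤s⁻¹ b<1+t) = m≤n+m _ _

  <S : 1 ≤ k → ∀ {b t} → b < t → t < S k b t
  <S k≥1 {t = t} b<t = <-≤-trans (j<p[j] t) (≤-trans (n≤n^k (p t) k≥1) (p^k≤S b<t))

-- The loops of the algorithm

record WhileRun (Q : ℕ → Set) (B ts : ℕ) (run : ℕ × ℕ) : Set where
  field
    start≤end : ts ≤ proj₁ run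
    holds     : ∀ t → ts ≤ t → t < proj₁ run → Q t
    fails     : ¬ Q (proj₁ run)
    tests     : proj₂ run + ts ≡ suc (proj₁ run)
    end≤      : ts ≤ suc B → proj₁ run ≤ suc B

while-run : ∀ {Q : ℕ → Set} (c : ℕ → Bool) → (∀ t → Reflects (Q t) (c t)) →
            ∀ B → (∀ t → Q t → t ≤ B) → ∀ fuel ts → B < fuel + ts → WhileRun Q B ts (while fuel c ts)
while-run c c-reflects B Q≤B zero ts B<ts = record
  { start≤end = ≤-refl
  ; holds     = λ t ts≤t t<ts → ⊥-elim (<⇒≱ t<ts ts≤t)
  ; fails     = λ Qts → <⇒≱ B<ts (Q≤B ts Qts)
  ; tests     = refl
  ; end≤      = id
  }
while-run {Q} c c-reflects B Q≤B (suc fuel) ts B<1+fuel+ts with c ts | c-reflects ts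
... | false | ofⁿ ¬Qts = record
  { start≤end = ≤-refl
  ; holds     = λ t ts≤t t<ts → ⊥-elim (<⇒≱ t<ts ts≤t)
  ; fails     = ¬Qts
  ; tests     = refl
  ; end≤      = id
  }
... | true | ofʸ Qts with while fuel c (suc ts)
                        | while-run c c-reflects B Q≤B fuel (suc ts) (subst (B <_) (sym (+-suc fuel ts)) B<1+fuel+ts)
...   | end , n | run = record
  { start≤end = ≤-trans (n≤1+n ts) start≤end
  ; holds     = holds′
  ; fails     = fails
  ; tests     = trans (sym (+-suc n ts)) tests
  ; end≤      = λ _ → end≤ (s≤s (Q≤B ts Qts))
  }
  where
  open WhileRun run
  holds′ : ∀ t → ts ≤ t → t < end → Q t
  holds′ t ts≤t t<end with m≤n⇒m<n∨m≡n ts≤t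
  ... | inj₂ refl = Qts
  ... | inj₁ ts<t = holds t ts<t t<end

module _ (k x1 x2 : ℕ) where

  open Algorithm k x1 x2

  Hit : ℕ → ℕ → Set
  Hit b t = b < t × t ≤ ℓ × x1 ≤ S k b t × S k b t < x2

  hit? : ∀ b t → Dec (Hit b t)
  hit? b t = b <? t ×-dec t ≤? ℓ ×-dec x1 ≤? S k b t ×-dec S k b t <? x2

  entry : ℕ → ℕ → ℕ × ℕ
  entry b t = S k b t , p (suc b)

  data TLoopStep (fuel b t : ℕ) : List (ℕ × ℕ) × ℕ → Set where
    beyond : ℓ < t → TLoopStep fuel b t ([] , 1)
    below  : t ≤ ℓ → S k b t < x1 →
             TLoopStep fuel b t (proj₁ (tLoop fuel b (suc t)) , suc (proj₂ (tLoop fuel b (suc t))))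
    inside : t ≤ ℓ → x1 ≤ S k b t → S k b t < x2 →
             TLoopStep fuel b t (entry b t ∷ proj₁ (tLoop fuel b (suc t)) , suc (proj₂ (tLoop fuel b (suc t))))
    above  : t ≤ ℓ → x2 ≤ S k b t → TLoopStep fuel b t ([] , 1)

  tLoop-step : ∀ fuel b t → (t ≤ ℓ → b ≤ t) → TLoopStep fuel b t (tLoop (suc fuel) b t)
  tLoop-step fuel b t b≤t with t ≤ᵇ ℓ | ≤ᵇ-reflects-≤ t ℓ
  ... | false | ofⁿ t≰ℓ = beyond (≰⇒> t≰ℓ)
  ... | true  | ofʸ t≤ℓ
    with (x1 ≤ᵇ (rr t ∸ rr b)) ∧ ((rr t ∸ rr b) <ᵇ x2)
       | ≤ᵇ-reflects-≤ x1 (rr t ∸ rr b) ×-reflects <ᵇ-reflects-< (rr t ∸ rr b) x2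
  ...   | true  | ofʸ (x1≤ , <x2) =
    subst (λ n → TLoopStep fuel b t ((n , p (suc b)) ∷ proj₁ rest , suc (proj₂ rest)))
          (sym r≡S) (inside t≤ℓ (subst (x1 ≤_) r≡S x1≤) (subst (_< x2) r≡S <x2))
    where
    rest : List (ℕ × ℕ) × ℕ
    rest = tLoop fuel b (suc t)
    r≡S : rr t ∸ rr b ≡ S k b t
    r≡S = r∸r≡S k (b≤t t≤ℓ)
  ...   | false | ofⁿ ¬inside with x2 ≤ᵇ (rr t ∸ rr b) | ≤ᵇ-reflects-≤ x2 (rr t ∸ rr b)
  ...     | true  | ofʸ x2≤ = above t≤ℓ (subst (x2 ≤_) (r∸r≡S k (b≤t t≤ℓ)) x2≤)
  ...     | false | ofⁿ x2≰ =
    below t≤ℓ (subst (_< x1) (r∸r≡S k (b≤t t≤ℓ)) (≰⇒> λ x1≤ → ¬inside (x1≤ , ≰⇒> x2≰)))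

  private
    step-b< : ∀ {b t} → (t ≤ ℓ → b < t) → t ≤ ℓ → (suc t ≤ ℓ → b < suc t)
    step-b< b<t t≤ℓ _ = m<n⇒m<1+n (b<t t≤ℓ)

    step-fuel : ∀ {fuel t} → ℓ < suc fuel + t → ℓ < fuel + suc t
    step-fuel {fuel} {t} = subst (ℓ <_) (sym (+-suc fuel t))

  tLoop-sound : ∀ fuel b t → (t ≤ ℓ → b < t) →
                ∀ {z} → z ∈ proj₁ (tLoop fuel b t) → ∃[ u ] Hit b u × z ≡ entry b u
  tLoop-sound (suc fuel) b t b<t z∈ with tLoop (suc fuel) b t | tLoop-step fuel b t (λ t≤ℓ → <⇒≤ (b<t t≤ℓ))
  tLoop-sound (suc fuel) b t b<t () | _ | beyond _
  tLoop-sound (suc fuel) b t b<t () | _ | above _ _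
  ... | _ | below t≤ℓ _ = tLoop-sound fuel b (suc t) (step-b< b<t t≤ℓ) z∈
  ... | _ | inside t≤ℓ x1≤ <x2 with z∈
  ...   | here refl = t , (b<t t≤ℓ , t≤ℓ , x1≤ , <x2) , refl
  ...   | there z∈rest = tLoop-sound fuel b (suc t) (step-b< b<t t≤ℓ) z∈rest

  tLoop-complete : ∀ fuel b t → (t ≤ ℓ → b < t) → ℓ < fuel + t →
                   ∀ {u} → t ≤ u → Hit b u → entry b u ∈ proj₁ (tLoop fuel b t)
  tLoop-complete zero b t _ ℓ<t t≤u (_ , u≤ℓ , _) = ⊥-elim (<⇒≱ ℓ<t (≤-trans t≤u u≤ℓ))
  tLoop-complete (suc fuel) b t b<t ℓ<1+fuel+t {u} t≤u hit@(_ , u≤ℓ , x1≤Su , Su<x2)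
    with tLoop (suc fuel) b t | tLoop-step fuel b t (λ t≤ℓ → <⇒≤ (b<t t≤ℓ))
  ... | _ | beyond ℓ<t = ⊥-elim (<⇒≱ ℓ<t (≤-trans t≤u u≤ℓ))
  ... | _ | above t≤ℓ x2≤St = ⊥-elim (<⇒≱ Su<x2 (≤-trans x2≤St (S-monoʳ-≤ k (<⇒≤ (b<t t≤ℓ)) t≤u)))
  ... | _ | below t≤ℓ St<x1 with m≤n⇒m<n∨m≡n t≤u
  ...   | inj₂ refl = ⊥-elim (<⇒≱ St<x1 x1≤Su)
  ...   | inj₁ t<u = tLoop-complete fuel b (suc t) (step-b< b<t t≤ℓ) (step-fuel ℓ<1+fuel+t) t<u hit
  tLoop-complete (suc fuel) b t b<t ℓ<1+fuel+t {u} t≤u hit | _ | inside t≤ℓ _ _ with m≤n⇒m<n∨m≡n t≤u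
  ...   | inj₂ refl = here refl
  ...   | inj₁ t<u = there (tLoop-complete fuel b (suc t) (step-b< b<t t≤ℓ) (step-fuel ℓ<1+fuel+t) t<u hit)

  tLoop-cost : ∀ fuel b t → (t ≤ ℓ → b < t) → (t ≤ ℓ → x1 ≤ S k b t) →
               proj₂ (tLoop fuel b t) ≡ suc (length (proj₁ (tLoop fuel b t)))
  tLoop-cost zero _ _ _ _ = refl
  tLoop-cost (suc fuel) b t b<t x1≤S with tLoop (suc fuel) b t | tLoop-step fuel b t (λ t≤ℓ → <⇒≤ (b<t t≤ℓ))
  ... | _ | beyond _ = refl
  ... | _ | above _ _ = refl
  ... | _ | below t≤ℓ St<x1 = ⊥-elim (<⇒≱ St<x1 (x1≤S t≤ℓ))
  ... | _ | inside t≤ℓ x1≤St _ = cong suc (tLoop-cost fuel b (suc t) (step-b< b<t t≤ℓ)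
                                   (λ _ → ≤-trans x1≤St (S-monoʳ-≤ k (<⇒≤ (b<t t≤ℓ)) (n≤1+n t))))

  hits : ℕ → ℕ → ℕ
  hits b n = ∑[ u < n ] 𝟙 (hit? b u)

  tLoop-length : ∀ fuel b t → (t ≤ ℓ → b < t) → t ≤ suc ℓ →
                 length (proj₁ (tLoop fuel b t)) + hits b t ≤ hits b (suc ℓ)
  tLoop-length zero b t _ t≤1+ℓ = ∑-≤-extend (λ u → 𝟙 (hit? b u)) t≤1+ℓ
  tLoop-length (suc fuel) b t b<t t≤1+ℓ
    with tLoop (suc fuel) b t | tLoop-step fuel b t (λ t≤ℓ → <⇒≤ (b<t t≤ℓ))
  ... | _ | beyond _ = ∑-≤-extend (λ u → 𝟙 (hit? b u)) t≤1+ℓ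
  ... | _ | above _ _ = ∑-≤-extend (λ u → 𝟙 (hit? b u)) t≤1+ℓ
  ... | _ | below t≤ℓ _ = ≤-trans
    (+-monoʳ-≤ (length (proj₁ (tLoop fuel b (suc t)))) (∑-≤-extend (λ u → 𝟙 (hit? b u)) (n≤1+n t)))
    (tLoop-length fuel b (suc t) (step-b< b<t t≤ℓ) (s≤s t≤ℓ))
  ... | _ | inside t≤ℓ x1≤St St<x2 = begin
    suc (length rest + hits b t)   ≡⟨ +-suc (length rest) (hits b t) ⟨
    length rest + suc (hits b t)   ≡⟨ cong (length rest +_) hits-suc ⟨
    length rest + hits b (suc t)   ≤⟨ tLoop-length fuel b (suc t) (step-b< b<t t≤ℓ) (s≤s t≤ℓ) ⟩
    hits b (suc ℓ)                 ∎
    where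
    open ≤-Reasoning
    rest : List (ℕ × ℕ)
    rest = proj₁ (tLoop fuel b (suc t))
    hits-suc : hits b (suc t) ≡ suc (hits b t)
    hits-suc = trans (∑-suc t (λ u → 𝟙 (hit? b u)))
      (trans (cong (hits b t +_) (𝟙-yes (hit? b t) (b<t t≤ℓ , t≤ℓ , x1≤St , St<x2))) (+-comm (hits b t) 1))

  -- t_s never passes a pair (b, t) with x1 ≤ S k b t; since S k b t decreases in b,
  -- this survives the step from b to b + 1.
  Inv : ℕ → ℕ → Set
  Inv b ts = ts ≤ suc ℓ × (∀ t → b < t → t < ts → S k b t < x1)

  module Iteration (b ts : ℕ) (inv : Inv b ts) where

    private
      first : ℕ × ℕ
      first = while (suc ℓ) (λ t → (t ≤ᵇ ℓ) ∧ (t ≤ᵇ b)) ts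

      ts₁ : ℕ
      ts₁ = proj₁ first

      second : ℕ × ℕ
      second = while (suc ℓ) (λ t → (t ≤ᵇ ℓ) ∧ ((rr t ∸ rr b) <ᵇ x1)) ts₁

      run₁ : WhileRun (λ t → t ≤ ℓ × t ≤ b) ℓ ts first
      run₁ = while-run _ (λ t → ≤ᵇ-reflects-≤ t ℓ ×-reflects ≤ᵇ-reflects-≤ t b)
                       ℓ (λ _ → proj₁) (suc ℓ) ts (s≤s (m≤m+n ℓ ts))

      run₂ : WhileRun (λ t → t ≤ ℓ × rr t ∸ rr b < x1) ℓ ts₁ second
      run₂ = while-run _ (λ t → ≤ᵇ-reflects-≤ t ℓ ×-reflects <ᵇ-reflects-< (rr t ∸ rr b) x1)
                       ℓ (λ _ → proj₁) (suc ℓ) ts₁ (s≤s (m≤m+n ℓ ts₁))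

      module R₁ = WhileRun run₁
      module R₂ = WhileRun run₂

    ts′ : ℕ
    ts′ = proj₁ second

    scan : List (ℕ × ℕ) × ℕ
    scan = tLoop (suc ℓ) b ts′

    b<ts′ : ts′ ≤ ℓ → b < ts′
    b<ts′ ts′≤ℓ = <-≤-trans (≰⇒> λ ts₁≤b → R₁.fails (≤-trans R₂.start≤end ts′≤ℓ , ts₁≤b)) R₂.start≤end

    skipped-below : ∀ t → b < t → t < ts′ → S k b t < x1
    skipped-below t b<t t<ts′ with t <? ts | t <? ts₁
    ... | yes t<ts | _ = proj₂ inv t b<t t<ts
    ... | no t≮ts | yes t<ts₁ = ⊥-elim (<⇒≱ b<t (proj₂ (R₁.holds t (≮⇒≥ t≮ts) t<ts₁)))
    ... | no _ | no t≮ts₁ = subst (_< x1) (r∸r≡S k (<⇒≤ b<t)) (proj₂ (R₂.holds t (≮⇒≥ t≮ts₁) t<ts′))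

    x1≤S[ts′] : ts′ ≤ ℓ → x1 ≤ S k b ts′
    x1≤S[ts′] ts′≤ℓ = subst (x1 ≤_) (r∸r≡S k (<⇒≤ (b<ts′ ts′≤ℓ))) (≮⇒≥ λ <x1 → R₂.fails (ts′≤ℓ , <x1))

    ts′≤1+ℓ : ts′ ≤ suc ℓ
    ts′≤1+ℓ = R₂.end≤ (R₁.end≤ (proj₁ inv))

    inv-next : Inv (suc b) ts′
    inv-next = ts′≤1+ℓ , λ t 1+b<t t<ts′ →
      ≤-<-trans (S-antimonoˡ k (<⇒≤ 1+b<t)) (skipped-below t (<⇒≤ 1+b<t) t<ts′)

    sound : ∀ {z} → z ∈ proj₁ scan → ∃[ t ] Hit b t × z ≡ entry b t
    sound = tLoop-sound (suc ℓ) b ts′ b<ts′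

    complete : ∀ {t} → Hit b t → entry b t ∈ proj₁ scan
    complete {t} hit@(b<t , _ , x1≤ , _) = tLoop-complete (suc ℓ) b ts′ b<ts′ (s≤s (m≤m+n ℓ ts′))
      (≮⇒≥ λ t<ts′ → <⇒≱ (skipped-below t b<t t<ts′) x1≤) hit

    length≤hits : length (proj₁ scan) ≤ hits b (suc ℓ)
    length≤hits = ≤-trans (m≤m+n _ _) (tLoop-length (suc ℓ) b ts′ b<ts′ ts′≤1+ℓ)

    cost : proj₂ (proj₂ (bStep b ts)) + ts ≡ 3 + ts′ + length (proj₁ scan)
    cost = begin
      c₁ + c₂ + c₃ + ts                          ≡⟨ solve 4 (λ c₁ c₂ c₃ ts → c₁ :+ c₂ :+ c₃ :+ ts
                                                                       := (c₁ :+ ts) :+ c₂ :+ c₃) refl c₁ c₂ c₃ ts ⟩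
      (c₁ + ts) + c₂ + c₃                        ≡⟨ cong (λ n → n + c₂ + c₃) R₁.tests ⟩
      suc ts₁ + c₂ + c₃                          ≡⟨ cong (λ n → suc n + c₃) (+-comm ts₁ c₂) ⟩
      suc (c₂ + ts₁) + c₃                        ≡⟨ cong (λ n → suc n + c₃) R₂.tests ⟩
      suc (suc ts′) + c₃                         ≡⟨ cong (suc (suc ts′) +_) (tLoop-cost (suc ℓ) b ts′ b<ts′ x1≤S[ts′]) ⟩
      suc (suc ts′) + suc (length (proj₁ scan))  ≡⟨ cong suc (+-suc (suc ts′) (length (proj₁ scan))) ⟩
      3 + ts′ + length (proj₁ scan)              ∎
      where
      open ≡-Reasoning
      open +-*-Solver
      c₁ c₂ c₃ : ℕ
      c₁ = proj₂ first
      c₂ = proj₂ second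
      c₃ = proj₂ scan

  cat≡++ : ∀ xs ys → cat xs ys ≡ xs ++ ys
  cat≡++ [] ys = refl
  cat≡++ (x ∷ xs) ys = cong (x ∷_) (cat≡++ xs ys)

  private
    module Iter {b ts} (inv : Inv b ts) = Iteration b ts inv

  bLoop-sound : ∀ fuel b ts → Inv b ts → ∀ {z} → z ∈ proj₁ (bLoop fuel b ts) →
                ∃[ b′ ] ∃[ t ] Hit b′ t × z ≡ entry b′ t
  bLoop-sound (suc fuel) b ts inv {z} z∈
    rewrite cat≡++ (proj₁ (Iter.scan inv)) (proj₁ (bLoop fuel (suc b) (Iter.ts′ inv)))
    with ∈-++⁻ (proj₁ (Iter.scan inv)) z∈
  ... | inj₁ z∈scan = b , Iter.sound inv z∈scan
  ... | inj₂ z∈rest = bLoop-sound fuel (suc b) (Iter.ts′ inv) (Iter.inv-next inv) z∈rest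

  bLoop-complete : ∀ fuel b ts → Inv b ts → ∀ {b′ t} → b ≤ b′ → b′ < b + fuel → Hit b′ t →
                   entry b′ t ∈ proj₁ (bLoop fuel b ts)
  bLoop-complete zero b ts inv b≤b′ b′<b+0 _ = ⊥-elim (<⇒≱ (subst (_ <_) (+-identityʳ b) b′<b+0) b≤b′)
  bLoop-complete (suc fuel) b ts inv {b′} b≤b′ b′<b+1+fuel hit
    rewrite cat≡++ (proj₁ (Iter.scan inv)) (proj₁ (bLoop fuel (suc b) (Iter.ts′ inv)))
    with m≤n⇒m<n∨m≡n b≤b′
  ... | inj₂ refl = ∈-++⁺ˡ (Iter.complete inv hit)
  ... | inj₁ b<b′ = ∈-++⁺ʳ (proj₁ (Iter.scan inv)) (bLoop-complete fuel (suc b) (Iter.ts′ inv) (Iter.inv-next inv)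
                                                     b<b′ (subst (b′ <_) (+-suc b fuel) b′<b+1+fuel) hit)

  bLoop-cost : ∀ fuel b ts → Inv b ts →
               proj₂ (bLoop fuel b ts) + ts ≤ 4 * fuel + length (proj₁ (bLoop fuel b ts)) + suc (suc ℓ)
  bLoop-cost zero b ts inv = s≤s (proj₁ inv)
  bLoop-cost (suc fuel) b ts inv = begin
    suc (c + c′) + ts
      ≡⟨ solve 3 (λ c c′ ts → con 1 :+ (c :+ c′) :+ ts := con 1 :+ (c :+ ts) :+ c′) refl c c′ ts ⟩
    suc (c + ts) + c′
      ≡⟨ cong (λ n → suc n + c′) (Iter.cost inv) ⟩
    4 + ts′ + len + c′
      ≡⟨ solve 3 (λ ts′ len c′ → con 4 :+ ts′ :+ len :+ c′ := con 4 :+ len :+ (c′ :+ ts′)) refl ts′ len c′ ⟩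
    4 + len + (c′ + ts′)
      ≤⟨ +-monoʳ-≤ (4 + len) (bLoop-cost fuel (suc b) ts′ (Iter.inv-next inv)) ⟩
    4 + len + (4 * fuel + len′ + L)
      ≡⟨ solve 4 (λ len fuel len′ L → con 4 :+ len :+ (con 4 :* fuel :+ len′ :+ L)
                                    := con 4 :* (con 1 :+ fuel) :+ (len :+ len′) :+ L) refl len fuel len′ L ⟩
    4 * suc fuel + (len + len′) + L
      ≡⟨ cong (λ n → 4 * suc fuel + n + L) (trans (sym (length-++ out)) (cong length (sym (cat≡++ out out′)))) ⟩
    4 * suc fuel + length (cat out out′) + L ∎
    where
    open ≤-Reasoning
    open +-*-Solver
    out out′ : List (ℕ × ℕ)
    out = proj₁ (Iter.scan inv)
    out′ = proj₁ (bLoop fuel (suc b) (Iter.ts′ inv))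
    ts′ L c c′ len len′ : ℕ
    ts′ = Iter.ts′ inv
    L = suc (suc ℓ)
    c = proj₂ (proj₂ (bStep b ts))
    c′ = proj₂ (bLoop fuel (suc b) ts′)
    len = length out
    len′ = length out′

  hitsBelow : ℕ → ℕ
  hitsBelow n = ∑[ b < n ] hits b (suc ℓ)

  bLoop-length : ∀ fuel b ts → Inv b ts → length (proj₁ (bLoop fuel b ts)) + hitsBelow b ≤ hitsBelow (b + fuel)
  bLoop-length zero b ts inv = ≤-reflexive (cong hitsBelow (sym (+-identityʳ b)))
  bLoop-length (suc fuel) b ts inv = begin
    length (cat out out′) + hitsBelow b
      ≡⟨ cong (_+ hitsBelow b) (trans (cong length (cat≡++ out out′)) (length-++ out)) ⟩
    length out + length out′ + hitsBelow b
      ≡⟨ solve 3 (λ a a′ h → a :+ a′ :+ h := a′ :+ (h :+ a)) refl (length out) (length out′) (hitsBelow b) ⟩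
    length out′ + (hitsBelow b + length out)
      ≤⟨ +-monoʳ-≤ (length out′) (+-monoʳ-≤ (hitsBelow b) (Iter.length≤hits inv)) ⟩
    length out′ + (hitsBelow b + hits b (suc ℓ))
      ≡⟨ cong (length out′ +_) (∑-suc b (λ i → hits i (suc ℓ))) ⟨
    length out′ + hitsBelow (suc b)
      ≤⟨ bLoop-length fuel (suc b) (Iter.ts′ inv) (Iter.inv-next inv) ⟩
    hitsBelow (suc b + fuel)
      ≡⟨ cong hitsBelow (+-suc b fuel) ⟨
    hitsBelow (b + suc fuel) ∎
    where
    open ≤-Reasoning
    open +-*-Solver
    out out′ : List (ℕ × ℕ)
    out = proj₁ (Iter.scan inv)
    out′ = proj₁ (bLoop fuel (suc b) (Iter.ts′ inv))

  Inv-start : Inv 0 1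
  Inv-start = s≤s z≤n , λ t 0<t t<1 → ⊥-elim (<⇒≱ 0<t (s≤s⁻¹ t<1))

  output-sound : ∀ {z} → z ∈ output → ∃[ b ] ∃[ t ] Hit b t × z ≡ entry b t
  output-sound = bLoop-sound (suc ℓ) 0 1 Inv-start

  output-complete : ∀ {b t} → Hit b t → entry b t ∈ output
  output-complete hit@(b<t , t≤ℓ , _) =
    bLoop-complete (suc ℓ) 0 1 Inv-start z≤n (s≤s (≤-trans (<⇒≤ b<t) t≤ℓ)) hit

  mainCost≤5*[1+ℓ]+length : mainCost ≤ 5 * suc ℓ + length output
  mainCost≤5*[1+ℓ]+length = s≤s⁻¹ (begin
    suc mainCost                             ≡⟨ +-comm 1 mainCost ⟩
    mainCost + 1                             ≤⟨ bLoop-cost (suc ℓ) 0 1 Inv-start ⟩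
    4 * suc ℓ + length output + suc (suc ℓ)  ≡⟨ solve 2 (λ ℓ o → con 4 :* (con 1 :+ ℓ) :+ o :+ (con 2 :+ ℓ)
                                                          := con 1 :+ (con 5 :* (con 1 :+ ℓ) :+ o)) refl ℓ (length output) ⟩
    suc (5 * suc ℓ + length output)          ∎)
    where
    open ≤-Reasoning
    open +-*-Solver

  length-output≤countPairs : length output ≤ countPairs hit? (suc ℓ)
  length-output≤countPairs =
    subst (_≤ hitsBelow (suc ℓ)) (+-identityʳ (length output)) (bLoop-length (suc ℓ) 0 1 Inv-start)

-- Counting representations

pairsBelow : List ℕ → List (ℕ × ℕ)
pairsBelow [] = []
pairsBelow (t ∷ ts) = map (_, t) (upTo t) ++ pairsBelow ts

-- The local functions of pairsUpTo are not in scope; the metavariables go and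
-- consAll are solved to them by unification against the unfolded definition.
pairsUpTo≡pairsBelow : ∀ n → pairsUpTo n ≡ pairsBelow (upTo (suc n))
pairsUpTo≡pairsBelow n = trans (sym go-applyUpTo) (go≡pairsBelow (applyUpTo suc n))
  where
  go : List ℕ → List (ℕ × ℕ)
  go = _

  consAll : ℕ → List ℕ → List (ℕ × ℕ) → List (ℕ × ℕ)
  consAll = _

  go-applyUpTo : go (applyUpTo suc n) ≡ pairsUpTo n
  go-applyUpTo with applyUpTo suc n
  ... | _ = refl

  go-∷ : ∀ t ts → go (t ∷ ts) ≡ consAll t (upTo t) (go ts)
  go-∷ t ts with upTo t | go ts
  ... | _ | _ = refl

  consAll≡ : ∀ t bs ys → consAll t bs ys ≡ map (_, t) bs ++ ys
  consAll≡ t [] ys = refl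
  consAll≡ t (b ∷ bs) ys = cong ((b , t) ∷_) (consAll≡ t bs ys)

  go≡pairsBelow : ∀ ts → go ts ≡ pairsBelow ts
  go≡pairsBelow [] = refl
  go≡pairsBelow (t ∷ ts) = trans (go-∷ t ts)
    (trans (consAll≡ t (upTo t) (go ts)) (cong (map (_, t) (upTo t) ++_) (go≡pairsBelow ts)))

∈-pairsBelow⁻ : ∀ ts {b t} → (b , t) ∈ pairsBelow ts → b < t
∈-pairsBelow⁻ (u ∷ ts) bt∈ with ∈-++⁻ (map (_, u) (upTo u)) bt∈
... | inj₂ bt∈rest = ∈-pairsBelow⁻ ts bt∈rest
... | inj₁ bt∈map with ∈-map⁻ (_, u) bt∈map
...   | _ , b∈upTo , refl = ∈-upTo⁻ b∈upTo

∈-pairsBelow⁺ : ∀ {ts b t} → t ∈ ts → b < t → (b , t) ∈ pairsBelow ts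
∈-pairsBelow⁺ {u ∷ ts} (here refl) b<t = ∈-++⁺ˡ (∈-map⁺ (_, u) (∈-upTo⁺ b<t))
∈-pairsBelow⁺ {u ∷ ts} (there t∈ts) b<t = ∈-++⁺ʳ (map (_, u) (upTo u)) (∈-pairsBelow⁺ t∈ts b<t)

sum-map-pairsBelow : ∀ (g : ℕ × ℕ → ℕ) ts →
                     sum (map g (pairsBelow ts)) ≡ sum (map (λ t → ∑[ b < t ] g (b , t)) ts)
sum-map-pairsBelow g [] = refl
sum-map-pairsBelow g (t ∷ ts) = begin
  sum (map g (column ++ pairsBelow ts))                     ≡⟨ cong sum (map-++ g column (pairsBelow ts)) ⟩
  sum (map g column ++ map g (pairsBelow ts))               ≡⟨ sum-++ (map g column) (map g (pairsBelow ts)) ⟩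
  sum (map g column) + sum (map g (pairsBelow ts))          ≡⟨ cong₂ _+_ (cong sum (sym (map-∘ (upTo t))))
                                                                         (sum-map-pairsBelow g ts) ⟩
  ∑[ b < t ] g (b , t) + sum (map (λ u → ∑[ b < u ] g (b , u)) ts) ∎
  where
  open ≡-Reasoning
  column : List (ℕ × ℕ)
  column = map (_, t) (upTo t)

private
  nonempty⇒∈ : {A : Set} (xs : List A) → 0 < length xs → ∃[ x ] x ∈ xs
  nonempty⇒∈ (x ∷ _) _ = x , here refl

0<f⇔Gleeful : ∀ {k} → 1 ≤ k → ∀ n → 0 < f k n ⇔ Gleeful k n
0<f⇔Gleeful {k} k≥1 n = mk⇔ gleeful 0<f
  where
  S≟n : ∀ bt → Dec (S k (proj₁ bt) (proj₂ bt) ≡ n)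
  S≟n bt = S k (proj₁ bt) (proj₂ bt) ≟ n
  gleeful : 0 < f k n → Gleeful k n
  gleeful 0<f with nonempty⇒∈ (filter S≟n (pairsUpTo n)) 0<f
  ... | (b , t) , bt∈ with ∈-filter⁻ S≟n {xs = pairsUpTo n} bt∈
  ...   | bt∈pairs , S≡n =
    b , t , ∈-pairsBelow⁻ (upTo (suc n)) (subst ((b , t) ∈_) (pairsUpTo≡pairsBelow n) bt∈pairs) , S≡n
  0<f : Gleeful k n → 0 < f k n
  0<f (b , t , b<t , refl) = ∈-length (∈-filter⁺ S≟n (subst ((b , t) ∈_) (sym (pairsUpTo≡pairsBelow n))
    (∈-pairsBelow⁺ (∈-upTo⁺ (s≤s (<⇒≤ (<S k k≥1 b<t)))) b<t)) refl)

module _ (k : ℕ) where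

  Represents : ℕ → ℕ → ℕ → Set
  Represents n b t = b < t × S k b t ≡ n

  represents? : ∀ n b t → Dec (Represents n b t)
  represents? n b t = b <? t ×-dec S k b t ≟ n

  RepresentsIn : ℕ → ℕ → ℕ → ℕ → Set
  RepresentsIn lo hi b t = b < t × lo < S k b t × S k b t ≤ hi

  representsIn? : ∀ lo hi b t → Dec (RepresentsIn lo hi b t)
  representsIn? lo hi b t = b <? t ×-dec lo <? S k b t ×-dec S k b t ≤? hi

  f≡countPairs : 1 ≤ k → ∀ {n m} → n < m → f k n ≡ countPairs (represents? n) m
  f≡countPairs k≥1 {n} {m} n<m = begin
    f k n                                             ≡⟨ length-filter≡sum-𝟙 S≟n (pairsUpTo n) ⟩
    sum (map (𝟙 ∘ S≟n) (pairsUpTo n))                 ≡⟨ cong (sum ∘ map (𝟙 ∘ S≟n)) (pairsUpTo≡pairsBelow n) ⟩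
    sum (map (𝟙 ∘ S≟n) (pairsBelow (upTo (suc n))))   ≡⟨ sum-map-pairsBelow (𝟙 ∘ S≟n) (upTo (suc n)) ⟩
    ∑[ t < suc n ] ∑[ b < t ] 𝟙 (S k b t ≟ n)         ≡⟨ ∑-cong (suc n) (λ t t≤n → column (≤-trans (s≤s⁻¹ t≤n) (<⇒≤ n<m))) ⟩
    ∑[ t < suc n ] ∑[ b < m ] 𝟙 (represents? n b t)   ≡⟨ ∑-extend (λ t → ∑[ b < m ] 𝟙 (represents? n b t)) n<m
                                                                  (λ t n<t _ → ∑-vanish m (λ b _ → none-beyond n<t)) ⟨
    ∑[ t < m ] ∑[ b < m ] 𝟙 (represents? n b t)       ≡⟨ ∑-swap m m (λ t b → 𝟙 (represents? n b t)) ⟩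
    countPairs (represents? n) m                      ∎
    where
    open ≡-Reasoning
    S≟n : ∀ bt → Dec (S k (proj₁ bt) (proj₂ bt) ≡ n)
    S≟n bt = S k (proj₁ bt) (proj₂ bt) ≟ n
    none-beyond : ∀ {b t} → n < t → 𝟙 (represents? n b t) ≡ 0
    none-beyond {b} {t} n<t =
      𝟙-no (represents? n b t) λ (b<t , S≡n) → <⇒≱ (<-trans n<t (<S k k≥1 b<t)) (≤-reflexive S≡n)
    column : ∀ {t} → t ≤ m → ∑[ b < t ] 𝟙 (S k b t ≟ n) ≡ ∑[ b < m ] 𝟙 (represents? n b t)
    column {t} t≤m = trans (∑-cong t (λ b b<t → 𝟙-cong (S k b t ≟ n) (represents? n b t) (b<t ,_) proj₂))
      (sym (∑-extend (λ b → 𝟙 (represents? n b t)) t≤m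
                     (λ b t≤b _ → 𝟙-no (represents? n b t) (λ (b<t , _) → <⇒≱ b<t t≤b))))

  s-mono-≤ : ∀ {x y} → x ≤ y → s k x ≤ s k y
  s-mono-≤ {x} {zero} z≤n = ≤-refl
  s-mono-≤ {x} {suc y} x≤1+y with m≤n⇒m<n∨m≡n x≤1+y
  ... | inj₂ refl = ≤-refl
  ... | inj₁ x<1+y = ≤-trans (s-mono-≤ (s≤s⁻¹ x<1+y)) (m≤m+n (s k y) (f k (suc y)))

  s∸s≡countPairs : 1 ≤ k → ∀ {x y m} → x ≤ y → y < m → s k y ∸ s k x ≡ countPairs (representsIn? x y) m
  s∸s≡countPairs k≥1 {x} {y} {m} x≤y y<m with m≤n⇒m<n∨m≡n x≤y
  ... | inj₂ refl = trans (n∸n≡0 (s k x)) (sym (∑-vanish m (λ b _ → ∑-vanish m (λ t _ →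
    𝟙-no (representsIn? x x b t) (λ (_ , x<S , S≤x) → <⇒≱ x<S S≤x)))))
  s∸s≡countPairs k≥1 {x} {suc y} {m} _ 1+y<m | inj₁ x<1+y = begin
    s k (suc y) ∸ s k x
      ≡⟨ +-∸-comm (f k (suc y)) (s-mono-≤ x≤y) ⟩
    s k y ∸ s k x + f k (suc y)
      ≡⟨ cong₂ _+_ (s∸s≡countPairs k≥1 x≤y (<-trans (n<1+n y) 1+y<m)) (f≡countPairs k≥1 1+y<m) ⟩
    countPairs (representsIn? x y) m + countPairs (represents? (suc y)) m
      ≡⟨ countPairs-⊎ (representsIn? x y) (represents? (suc y)) (representsIn? x (suc y)) m to from disjoint ⟩
    countPairs (representsIn? x (suc y)) m ∎
    where
    open ≡-Reasoning
    x≤y : x ≤ y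
    x≤y = s≤s⁻¹ x<1+y
    to : ∀ {b t} → RepresentsIn x y b t ⊎ Represents (suc y) b t → RepresentsIn x (suc y) b t
    to (inj₁ (b<t , x<S , S≤y)) = b<t , x<S , m≤n⇒m≤1+n S≤y
    to (inj₂ (b<t , S≡1+y)) = b<t , subst (x <_) (sym S≡1+y) x<1+y , ≤-reflexive S≡1+y
    from : ∀ {b t} → RepresentsIn x (suc y) b t → RepresentsIn x y b t ⊎ Represents (suc y) b t
    from (b<t , x<S , S≤1+y) with m≤n⇒m<n∨m≡n S≤1+y
    ... | inj₁ S<1+y = inj₁ (b<t , x<S , s≤s⁻¹ S<1+y)
    ... | inj₂ S≡1+y = inj₂ (b<t , S≡1+y)
    disjoint : ∀ {b t} → RepresentsIn x y b t → Represents (suc y) b t → ⊥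
    disjoint (_ , _ , S≤y) (_ , S≡1+y) = 1+n≰n (subst (_≤ y) S≡1+y S≤y)

-- Logarithms

2^-cancel-≤ : ∀ {a b} → 2 ^ a ≤ 2 ^ b → a ≤ b
2^-cancel-≤ 2^a≤2^b = ≮⇒≥ λ b<a → <⇒≱ (^-monoʳ-< 2 (s≤s (s≤s z≤n)) b<a) 2^a≤2^b

n<2^n : ∀ n → n < 2 ^ n
n<2^n zero = s≤s z≤n
n<2^n (suc n) =
  ≤-trans (+-mono-≤ (m^n>0 2 n) (n<2^n n)) (≤-reflexive (cong (2 ^ n +_) (sym (+-identityʳ (2 ^ n)))))

n*n≤2*2^n : ∀ n → n * n ≤ 2 * 2 ^ n
n*n≤2*2^n zero = z≤n
n*n≤2*2^n (suc n) = begin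
  suc n * suc n              ≡⟨ solve 1 (λ n → (con 1 :+ n) :* (con 1 :+ n) := n :* n :+ (con 1 :+ n :+ n)) refl n ⟩
  n * n + (suc n + n)        ≤⟨ +-mono-≤ (n*n≤2*2^n n) (+-mono-≤ (n<2^n n) (<⇒≤ (n<2^n n))) ⟩
  2 * 2 ^ n + (2 ^ n + 2 ^ n) ≡⟨ solve 1 (λ x → con 2 :* x :+ (x :+ x) := con 2 :* (con 2 :* x)) refl (2 ^ n) ⟩
  2 * 2 ^ suc n              ∎
  where
  open ≤-Reasoning
  open +-*-Solver

2^⌊log₂⌋≤ : ∀ n → 1 ≤ n → 2 ^ ⌊log₂ n ⌋ ≤ n
2^⌊log₂⌋≤ n = go n (<-wellFounded n)
  where
  go : ∀ n (rec : Acc _<_ n) → 1 ≤ n → 2 ^ ⌊log2⌋ n rec ≤ n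
  go 1 _ _ = ≤-refl
  go (suc (suc m)) (acc rs) _ = begin
    2 * 2 ^ ⌊log2⌋ (suc ⌊ m /2⌋) _  ≤⟨ *-monoʳ-≤ 2 (go (suc ⌊ m /2⌋) _ (s≤s z≤n)) ⟩
    2 * suc ⌊ m /2⌋                ≡⟨ *-suc 2 ⌊ m /2⌋ ⟩
    2 + (⌊ m /2⌋ + (⌊ m /2⌋ + 0))  ≡⟨ cong (λ h → 2 + (⌊ m /2⌋ + h)) (+-identityʳ ⌊ m /2⌋) ⟩
    2 + (⌊ m /2⌋ + ⌊ m /2⌋)        ≤⟨ +-monoʳ-≤ 2 (+-monoʳ-≤ ⌊ m /2⌋ (⌊n/2⌋≤⌈n/2⌉ m)) ⟩
    2 + (⌊ m /2⌋ + ⌈ m /2⌉)        ≡⟨ cong (2 +_) (⌊n/2⌋+⌈n/2⌉≡n m) ⟩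
    2 + m                          ∎
    where open ≤-Reasoning

2^≤⇒≤⌊log₂⌋ : ∀ {m n} → 2 ^ m ≤ n → m ≤ ⌊log₂ n ⌋
2^≤⇒≤⌊log₂⌋ {m} {n} 2^m≤n = subst (_≤ ⌊log₂ n ⌋) (⌊log₂[2^n]⌋≡n m) (⌊log₂⌋-mono-≤ 2^m≤n)

<2^1+⌊log₂⌋ : ∀ n → n < 2 ^ suc ⌊log₂ n ⌋
<2^1+⌊log₂⌋ n = ≰⇒> λ 2^[1+log]≤n → 1+n≰n (2^≤⇒≤⌊log₂⌋ 2^[1+log]≤n)

⌊log₂⌋≤ : ∀ {n m} → n ≤ 2 ^ m → ⌊log₂ n ⌋ ≤ m
⌊log₂⌋≤ {n} {m} n≤2^m = subst (⌊log₂ n ⌋ ≤_) (⌊log₂[2^n]⌋≡n m) (⌊log₂⌋-mono-≤ n≤2^m)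

⌊log₂⌋≤n : ∀ n → ⌊log₂ n ⌋ ≤ n
⌊log₂⌋≤n n = ⌊log₂⌋≤ (<⇒≤ (n<2^n n))

⌊log₂⌋*2^⌊log₂⌋≤n*n : ∀ n → ⌊log₂ n ⌋ * 2 ^ ⌊log₂ n ⌋ ≤ n * n
⌊log₂⌋*2^⌊log₂⌋≤n*n zero = z≤n
⌊log₂⌋*2^⌊log₂⌋≤n*n (suc n) = *-mono-≤ (⌊log₂⌋≤n (suc n)) (2^⌊log₂⌋≤ (suc n) (s≤s z≤n))

loglog≤ : ∀ {k} → 1 ≤ k → ∀ x → loglog x ≤ ⌊log₂ ⌊log₂ iroot k x ⌋ ⌋ + suc k
loglog≤ {k} k≥1 x = begin
  ⌊log₂ ⌊log₂ x ⌋ ⌋         ≤⟨ ⌊log₂⌋-mono-≤ {⌊log₂ x ⌋} {suc a * k} (⌊log₂⌋≤ x≤2^[[1+a]*k]) ⟩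
  ⌊log₂ (suc a * k) ⌋       ≤⟨ ⌊log₂⌋≤ [1+a]*k≤ ⟩
  suc j + k                 ≡⟨ +-suc j k ⟨
  j + suc k                 ∎
  where
  open ≤-Reasoning
  a j : ℕ
  a = ⌊log₂ iroot k x ⌋
  j = ⌊log₂ a ⌋
  x≤2^[[1+a]*k] : x ≤ 2 ^ (suc a * k)
  x≤2^[[1+a]*k] = ≤-trans (<⇒≤ (<[1+iroot]^ k≥1 x))
                    (≤-trans (^-monoˡ-≤ k (<2^1+⌊log₂⌋ (iroot k x))) (≤-reflexive (^-*-assoc 2 (suc a) k)))
  [1+a]*k≤ : suc a * k ≤ 2 ^ (suc j + k)
  [1+a]*k≤ = ≤-trans (*-mono-≤ (<2^1+⌊log₂⌋ a) (<⇒≤ (n<2^n k)))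
                     (≤-reflexive (sym (^-distribˡ-+-* 2 (suc j) k)))

loglog≤[2+k]*loglog : ∀ {k} → 1 ≤ k → ∀ x → 4 ≤ iroot k x → loglog x ≤ (2 + k) * loglog (iroot k x)
loglog≤[2+k]*loglog {k} k≥1 x 4≤N = ≤-trans (loglog≤ k≥1 x)
  (+-monoʳ-≤ (loglog (iroot k x)) (≤-trans (≤-reflexive (sym (*-identityʳ (suc k)))) (*-monoʳ-≤ (suc k) 1≤j)))
  where
  1≤j : 1 ≤ loglog (iroot k x)
  1≤j = 2^≤⇒≤⌊log₂⌋ (2^≤⇒≤⌊log₂⌋ 4≤N)

-- A Chebyshev bound

nCk*[k!*[n∸k]!]≡n! : ∀ {n k} → k ≤ n → (n C k) * (k ! * (n ∸ k) !) ≡ n !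
nCk*[k!*[n∸k]!]≡n! {n} {k} k≤n = trans (cong (_* (k ! * (n ∸ k) !)) (nCk≡n!/k![n-k]! k≤n))
                                       (m/n*n≡m {{k !* (n ∸ k) !≢0}} (k![n∸k]!∣n! k≤n))

nCk>0 : ∀ {n k} → k ≤ n → 0 < n C k
nCk>0 {n} {k} k≤n with n C k | nCk*[k!*[n∸k]!]≡n! k≤n
... | zero  | 0≡n! = ⊥-elim (<⇒≢ (1≤n! n) 0≡n!)
... | suc _ | _ = s≤s z≤n

nCk≤2^n : ∀ n k → n C k ≤ 2 ^ n
nCk≤2^n n zero = m^n>0 2 n
nCk≤2^n zero (suc k) = z≤n
nCk≤2^n (suc n) (suc k) = begin
  suc n C suc k          ≡⟨ nCk+nC[k+1]≡[n+1]C[k+1] n k ⟨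
  n C k + n C suc k      ≤⟨ +-mono-≤ (nCk≤2^n n k) (nCk≤2^n n (suc k)) ⟩
  2 ^ n + 2 ^ n          ≡⟨ cong (2 ^ n +_) (+-identityʳ (2 ^ n)) ⟨
  2 ^ suc n              ∎
  where open ≤-Reasoning

prime∤n! : ∀ {q} → Prime q → ∀ {n} → n < q → ¬ q ∣ n !
prime∤n! q-prime {zero} _ q∣1 = <⇒≢ (prime⇒≥2 q-prime) (sym (∣1⇒≡1 q∣1))
prime∤n! q-prime {suc n} 1+n<q q∣[1+n]! with euclidsLemma (suc n) (n !) q-prime q∣[1+n]!
... | inj₁ q∣1+n = <⇒≱ 1+n<q (∣⇒≤ q∣1+n)
... | inj₂ q∣n! = prime∤n! q-prime (<-trans (n<1+n n) 1+n<q) q∣n!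

prime∣nCk : ∀ {q n k} → Prime q → k ≤ n → k < q → n ∸ k < q → q ≤ n → q ∣ n C k
prime∣nCk {q} {n} {k} q-prime k≤n k<q n∸k<q q≤n
  with euclidsLemma (n C k) (k ! * (n ∸ k) !) q-prime
         (subst (q ∣_) (sym (nCk*[k!*[n∸k]!]≡n! k≤n))
                (∣-trans (n∣n! q {{prime⇒nonZero q-prime}}) (m≤n⇒m!∣n! q≤n)))
... | inj₁ q∣nCk = q∣nCk
... | inj₂ q∣k!*[n∸k]! with euclidsLemma (k !) ((n ∸ k) !) q-prime q∣k!*[n∸k]!
...   | inj₁ q∣k! = ⊥-elim (prime∤n! q-prime k<q q∣k!)
...   | inj₂ q∣[n∸k]! = ⊥-elim (prime∤n! q-prime n∸k<q q∣[n∸k]!)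

primeProduct : ℕ → ℕ → ℕ
primeProduct y zero = 1
primeProduct y (suc N) = primeProduct y N * suc N ^ 𝟙 (y <? suc N ×-dec prime? (suc N))

primeProduct>0 : ∀ y N → 0 < primeProduct y N
primeProduct>0 y zero = s≤s z≤n
primeProduct>0 y (suc N) = *-mono-≤ (primeProduct>0 y N) (m^n>0 (suc N) (𝟙 (y <? suc N ×-dec prime? (suc N))))

primeProduct-≡1 : ∀ {y N} → N ≤ y → primeProduct y N ≡ 1
primeProduct-≡1 {y} {zero} _ = refl
primeProduct-≡1 {y} {suc N} 1+N≤y
  rewrite primeProduct-≡1 (<⇒≤ 1+N≤y)
        | 𝟙-no (y <? suc N ×-dec prime? (suc N)) (λ (y<1+N , _) → <⇒≱ y<1+N 1+N≤y) = refl

primeProduct-split : ∀ {y M N} → y ≤ M → M ≤ N → primeProduct y N ≡ primeProduct y M * primeProduct M N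
primeProduct-split {y} {M} {N} y≤M M≤N with m≤n⇒m<n∨m≡n M≤N
... | inj₂ refl rewrite primeProduct-≡1 {M} {M} ≤-refl = sym (*-identityʳ (primeProduct y M))
primeProduct-split {y} {M} {suc N} y≤M _ | inj₁ M<1+N
  rewrite primeProduct-split y≤M (s≤s⁻¹ M<1+N)
        | 𝟙-cong (y <? suc N ×-dec prime? (suc N)) (M <? suc N ×-dec prime? (suc N))
                 (λ (_ , q-prime) → M<1+N , q-prime) (λ (_ , q-prime) → <-≤-trans (s≤s y≤M) M<1+N , q-prime) =
  *-assoc (primeProduct y M) (primeProduct M N) _

primeProduct-antimono : ∀ {y z} N → y ≤ z → primeProduct z N ≤ primeProduct y N
primeProduct-antimono zero _ = ≤-refl
primeProduct-antimono {y} {z} (suc N) y≤z = *-mono-≤ (primeProduct-antimono N y≤z)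
  (^-monoʳ-≤ (suc N) (𝟙-mono (z <? suc N ×-dec prime? (suc N)) (y <? suc N ×-dec prime? (suc N))
                              (λ (z<1+N , q-prime) → ≤-<-trans y≤z z<1+N , q-prime)))

prime∤primeProduct : ∀ {q} → Prime q → ∀ y {N} → N < q → ¬ q ∣ primeProduct y N
prime∤primeProduct q-prime y {zero} _ q∣1 = <⇒≢ (prime⇒≥2 q-prime) (sym (∣1⇒≡1 q∣1))
prime∤primeProduct {q} q-prime y {suc N} 1+N<q = last-factor (y <? suc N ×-dec prime? (suc N))
  where
  last-factor : (d : Dec (y < suc N × Prime (suc N))) → ¬ q ∣ primeProduct y N * suc N ^ 𝟙 d
  last-factor d q∣P with euclidsLemma (primeProduct y N) (suc N ^ 𝟙 d) q-prime q∣P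
  ... | inj₁ q∣P′ = prime∤primeProduct q-prime y (<-trans (n<1+n N) 1+N<q) q∣P′
  last-factor (yes _) _ | inj₂ q∣1+N = <⇒≱ 1+N<q (∣⇒≤ (subst (q ∣_) (*-identityʳ (suc N)) q∣1+N))
  last-factor (no _) _ | inj₂ q∣1 = <⇒≢ (prime⇒≥2 q-prime) (sym (∣1⇒≡1 q∣1))

primeProduct-∣ : ∀ {X} y N → (∀ {q} → Prime q → y < q → q ≤ N → q ∣ X) → primeProduct y N ∣ X
primeProduct-∣ y zero _ = 1∣ _
primeProduct-∣ {X} y (suc N) primes∣X = last-factor (y <? suc N ×-dec prime? (suc N))
  where
  P∣X : primeProduct y N ∣ X
  P∣X = primeProduct-∣ y N (λ q-prime y<q q≤N → primes∣X q-prime y<q (m≤n⇒m≤1+n q≤N))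
  last-factor : (d : Dec (y < suc N × Prime (suc N))) → primeProduct y N * suc N ^ 𝟙 d ∣ X
  last-factor (no _) = subst (_∣ X) (sym (*-identityʳ (primeProduct y N))) P∣X
  last-factor (yes (y<1+N , 1+N-prime)) with P∣X
  ... | divides u X≡u*P
    with euclidsLemma u (primeProduct y N) 1+N-prime (subst (suc N ∣_) X≡u*P (primes∣X 1+N-prime y<1+N ≤-refl))
  ...   | inj₂ 1+N∣P = ⊥-elim (prime∤primeProduct 1+N-prime y ≤-refl 1+N∣P)
  ...   | inj₁ (divides v u≡v*[1+N]) = divides v (begin
    X                                      ≡⟨ X≡u*P ⟩
    u * primeProduct y N                   ≡⟨ cong (_* primeProduct y N) u≡v*[1+N] ⟩
    v * suc N * primeProduct y N           ≡⟨ solve 3 (λ v n P → v :* n :* P := v :* (P :* (n :* con 1)))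
                                                      refl v (suc N) (primeProduct y N) ⟩
    v * (primeProduct y N * (suc N * 1))   ∎)
    where
    open ≡-Reasoning
    open +-*-Solver

3*⌈n/2⌉≤2*n : ∀ n → 2 ≤ n → 3 * ⌈ n /2⌉ ≤ 2 * n
3*⌈n/2⌉≤2*n 1 (s≤s ())
3*⌈n/2⌉≤2*n 2 _ = s≤s (s≤s (s≤s z≤n))
3*⌈n/2⌉≤2*n 3 _ = ≤-refl
3*⌈n/2⌉≤2*n (suc (suc n@(suc (suc _)))) _ = begin
  3 * suc ⌈ n /2⌉    ≡⟨ *-suc 3 ⌈ n /2⌉ ⟩
  3 + 3 * ⌈ n /2⌉    ≤⟨ +-monoʳ-≤ 3 (3*⌈n/2⌉≤2*n n (s≤s (s≤s z≤n))) ⟩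
  3 + 2 * n          ≤⟨ +-monoˡ-≤ (2 * n) (n≤1+n 3) ⟩
  4 + 2 * n          ≡⟨ *-distribˡ-+ 2 2 n ⟨
  2 * (2 + n)        ∎
  where open ≤-Reasoning

-- Erdős: the primes in (⌈N/2⌉, N] all divide N C ⌈N/2⌉ ≤ 2^N.
primeProduct≤8^ : ∀ N → primeProduct 0 N ≤ 2 ^ (3 * N)
primeProduct≤8^ = <-rec (λ N → primeProduct 0 N ≤ 2 ^ (3 * N)) bound
  where
  bound : ∀ N → (∀ {M} → M < N → primeProduct 0 M ≤ 2 ^ (3 * M)) → primeProduct 0 N ≤ 2 ^ (3 * N)
  bound 0 _ = ≤-refl
  bound 1 _ = s≤s z≤n
  bound N@(suc (suc n)) IH = begin
    primeProduct 0 N                     ≡⟨ primeProduct-split z≤n h≤N ⟩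
    primeProduct 0 h * primeProduct h N  ≤⟨ *-mono-≤ (IH h<N) (∣⇒≤ {{>-nonZero (nCk>0 h≤N)}} (primeProduct-∣ h N primes∣NCh)) ⟩
    2 ^ (3 * h) * (N C h)                ≤⟨ *-monoʳ-≤ (2 ^ (3 * h)) (nCk≤2^n N h) ⟩
    2 ^ (3 * h) * 2 ^ N                  ≡⟨ ^-distribˡ-+-* 2 (3 * h) N ⟨
    2 ^ (3 * h + N)                      ≤⟨ ^-monoʳ-≤ 2 (+-monoˡ-≤ N (3*⌈n/2⌉≤2*n N (s≤s (s≤s z≤n)))) ⟩
    2 ^ (2 * N + N)                      ≡⟨ cong (2 ^_) (solve 1 (λ N → con 2 :* N :+ N := con 3 :* N) refl N) ⟩
    2 ^ (3 * N)                          ∎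
    where
    open ≤-Reasoning
    open +-*-Solver
    h : ℕ
    h = ⌈ N /2⌉
    h<N : h < N
    h<N = ⌈n/2⌉<n n
    h≤N : h ≤ N
    h≤N = <⇒≤ h<N
    N∸h≤h : N ∸ h ≤ h
    N∸h≤h = subst (λ n → n ∸ h ≤ h) (⌊n/2⌋+⌈n/2⌉≡n N)
                  (subst (_≤ h) (sym (m+n∸n≡m ⌊ N /2⌋ h)) (⌊n/2⌋≤⌈n/2⌉ N))
    primes∣NCh : ∀ {q} → Prime q → h < q → q ≤ N → q ∣ N C h
    primes∣NCh q-prime h<q q≤N = prime∣nCk q-prime h≤N h<q (≤-<-trans N∸h≤h h<q) q≤N

z^π≤ : ∀ {z} y N → 1 ≤ z → z ≤ suc y → z ^ π N ≤ z ^ π y * primeProduct y N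
z^π≤ {z} y zero 1≤z _ =
  ≤-trans (m^n>0 z {{>-nonZero 1≤z}} (π y)) (≤-reflexive (sym (*-identityʳ (z ^ π y))))
z^π≤ {z} y (suc N) 1≤z z≤1+y rewrite π-suc N = last (prime? (suc N)) (y <? suc N)
  where
  IH : z ^ π N ≤ z ^ π y * primeProduct y N
  IH = z^π≤ y N 1≤z z≤1+y
  last : (prime : Dec (Prime (suc N))) (y<1+N : Dec (y < suc N)) →
         z ^ (π N + 𝟙 prime) ≤ z ^ π y * (primeProduct y N * suc N ^ 𝟙 (y<1+N ×-dec prime))
  last (no ¬prime) y<1+N
    rewrite +-identityʳ (π N) | 𝟙-no (y<1+N ×-dec no ¬prime) (¬prime ∘ proj₂)
          | *-identityʳ (primeProduct y N) = IH
  last (yes _) (yes y<1+N) = begin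
    z ^ (π N + 1)                                   ≡⟨ ^-distribˡ-+-* z (π N) 1 ⟩
    z ^ π N * (z * 1)                               ≤⟨ *-mono-≤ IH (*-monoˡ-≤ 1 (≤-trans z≤1+y y<1+N)) ⟩
    z ^ π y * primeProduct y N * (suc N * 1)        ≡⟨ *-assoc (z ^ π y) (primeProduct y N) (suc N * 1) ⟩
    z ^ π y * (primeProduct y N * (suc N * 1))      ∎
    where open ≤-Reasoning
  last (yes 1+N-prime) (no y≮1+N) = begin
    z ^ (π N + 1)                  ≤⟨ ^-monoʳ-≤ z {{>-nonZero 1≤z}} πN+1≤πy ⟩
    z ^ π y                        ≡⟨ *-identityʳ (z ^ π y) ⟨
    z ^ π y * 1                    ≤⟨ *-monoʳ-≤ (z ^ π y) (*-monoˡ-≤ 1 (primeProduct>0 y N)) ⟩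
    z ^ π y * (primeProduct y N * 1) ∎
    where
    open ≤-Reasoning
    πN+1≤πy : π N + 1 ≤ π y
    πN+1≤πy = subst (_≤ π y) (+-comm 1 (π N))
                    (<-≤-trans (π-mono-<-prime (n<1+n N) 1+N-prime) (π-mono-≤ (≮⇒≥ y≮1+N)))

π*loglog≤ : ∀ N → π N * ⌊log₂ ⌊log₂ N ⌋ ⌋ ≤ 5 * N
π*loglog≤ zero = z≤n
π*loglog≤ N@(suc _) = begin
  π N * j               ≡⟨ *-comm (π N) j ⟩
  j * π N               ≤⟨ 2^-cancel-≤ 2^[j*πN]≤ ⟩
  j * y + 3 * N         ≤⟨ +-monoˡ-≤ (3 * N) j*y≤2*N ⟩
  2 * N + 3 * N         ≡⟨ *-distribʳ-+ N 2 3 ⟨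
  5 * N                 ∎
  where
  open ≤-Reasoning
  j y : ℕ
  j = ⌊log₂ ⌊log₂ N ⌋ ⌋
  y = 2 ^ j
  2^[j*πN]≤ : 2 ^ (j * π N) ≤ 2 ^ (j * y + 3 * N)
  2^[j*πN]≤ = begin
    2 ^ (j * π N)                ≡⟨ ^-*-assoc 2 j (π N) ⟨
    y ^ π N                      ≤⟨ z^π≤ y N (m^n>0 2 j) (n≤1+n y) ⟩
    y ^ π y * primeProduct y N   ≤⟨ *-mono-≤ (^-monoʳ-≤ y {{>-nonZero (m^n>0 2 j)}} (π≤ y))
                                             (≤-trans (primeProduct-antimono N z≤n) (primeProduct≤8^ N)) ⟩
    y ^ y * 2 ^ (3 * N)          ≡⟨ cong (_* 2 ^ (3 * N)) (^-*-assoc 2 j y) ⟩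
    2 ^ (j * y) * 2 ^ (3 * N)    ≡⟨ ^-distribˡ-+-* 2 (j * y) (3 * N) ⟨
    2 ^ (j * y + 3 * N)          ∎
  j*y≤2*N : j * y ≤ 2 * N
  j*y≤2*N = begin
    j * y                        ≤⟨ ⌊log₂⌋*2^⌊log₂⌋≤n*n ⌊log₂ N ⌋ ⟩
    ⌊log₂ N ⌋ * ⌊log₂ N ⌋        ≤⟨ n*n≤2*2^n ⌊log₂ N ⌋ ⟩
    2 * 2 ^ ⌊log₂ N ⌋            ≤⟨ *-monoʳ-≤ 2 (2^⌊log₂⌋≤ N (s≤s z≤n)) ⟩
    2 * N                        ∎

-- Correctness and cost

module _ {k : ℕ} (k≥1 : 1 ≤ k) (x1 x2 : ℕ) where

  open Algorithm k x1 x2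

  S<x2⇒t≤ℓ : ∀ {b t} → b < t → S k b t < x2 → t ≤ ℓ
  S<x2⇒t≤ℓ {b} {t} b<t S<x2 =
    ≤-trans (j≤π[p[j]] t) (π-mono-≤ (Equivalence.to (^≤⇔≤iroot k≥1) (<⇒≤ (≤-<-trans (p^k≤S k b<t) S<x2))))

  ℓ≤x2 : ℓ ≤ x2
  ℓ≤x2 = ≤-trans (π≤ (iroot k x2)) (≤-trans (n≤n^k (iroot k x2) k≥1) (iroot-^≤ k≥1 x2))

  output-lists-gleeful : ∀ n → (x1 ≤ n × n < x2 × 0 < f k n) ⇔ (n ∈ map proj₁ output)
  output-lists-gleeful n = mk⇔ listed gleeful
    where
    listed : x1 ≤ n × n < x2 × 0 < f k n → n ∈ map proj₁ output
    listed (x1≤n , n<x2 , 0<f) with Equivalence.to (0<f⇔Gleeful k≥1 n) 0<f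
    ... | b , t , b<t , refl = ∈-map⁺ proj₁ (output-complete k x1 x2 (b<t , S<x2⇒t≤ℓ b<t n<x2 , x1≤n , n<x2))
    gleeful : n ∈ map proj₁ output → x1 ≤ n × n < x2 × 0 < f k n
    gleeful n∈ with ∈-map⁻ proj₁ n∈
    ... | z , z∈ , refl with output-sound k x1 x2 z∈
    ...   | b , t , (b<t , _ , x1≤S , S<x2) , refl =
      x1≤S , S<x2 , Equivalence.from (0<f⇔Gleeful k≥1 (S k b t)) (b , t , b<t , refl)

  output-lists-first-prime : ∀ b t → b < t → x1 ≤ S k b t → S k b t < x2 → (S k b t , p (b + 1)) ∈ output
  output-lists-first-prime b t b<t x1≤S S<x2 = subst (λ j → (S k b t , p j) ∈ output) (+-comm 1 b)
    (output-complete k x1 x2 (b<t , S<x2⇒t≤ℓ b<t S<x2 , x1≤S , S<x2))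

  length-output≤ : x1 ≤ x2 → length output ≤ (s k x2 ∸ s k x1) + suc ℓ
  length-output≤ x1≤x2 = begin
    length output
      ≤⟨ length-output≤countPairs k x1 x2 ⟩
    countPairs (hit? k x1 x2) (suc ℓ)
      ≤⟨ countPairs-≤-⊎ (representsIn? k x1 x2) (represents? k x1) (hit? k x1 x2) (suc ℓ) hit⇒ ⟩
    countPairs (representsIn? k x1 x2) (suc ℓ) + countPairs (represents? k x1) (suc ℓ)
      ≤⟨ +-mono-≤ in-range at-x1 ⟩
    (s k x2 ∸ s k x1) + suc ℓ ∎
    where
    open ≤-Reasoning
    hit⇒ : ∀ {b t} → Hit k x1 x2 b t → RepresentsIn k x1 x2 b t ⊎ Represents k x1 b t
    hit⇒ (b<t , _ , x1≤S , S<x2) with m≤n⇒m<n∨m≡n x1≤S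
    ... | inj₁ x1<S = inj₁ (b<t , x1<S , <⇒≤ S<x2)
    ... | inj₂ x1≡S = inj₂ (b<t , sym x1≡S)
    in-range : countPairs (representsIn? k x1 x2) (suc ℓ) ≤ s k x2 ∸ s k x1
    in-range = ≤-trans (countPairs-≤-extend (representsIn? k x1 x2) (s≤s ℓ≤x2))
                       (≤-reflexive (sym (s∸s≡countPairs k k≥1 x1≤x2 ≤-refl)))
    at-x1 : countPairs (represents? k x1) (suc ℓ) ≤ suc ℓ
    at-x1 = ≤-trans (∑-≤-* (suc ℓ) 1 (λ b _ → ∑-𝟙-≤1 (suc ℓ) (represents? k x1 b)
                      (λ (b<t , St≡x1) (b<u , Su≡x1) → S-injectiveʳ k b<t b<u (trans St≡x1 (sym Su≡x1)))))
                    (≤-reflexive (*-identityʳ (suc ℓ)))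

  mainCost≤ : x1 ≤ x2 → mainCost ≤ 6 * suc ℓ + (s k x2 ∸ s k x1)
  mainCost≤ x1≤x2 = begin
    mainCost                                 ≤⟨ mainCost≤5*[1+ℓ]+length k x1 x2 ⟩
    5 * suc ℓ + length output                ≤⟨ +-monoʳ-≤ (5 * suc ℓ) (length-output≤ x1≤x2) ⟩
    5 * suc ℓ + ((s k x2 ∸ s k x1) + suc ℓ)  ≡⟨ solve 2 (λ l d → con 5 :* l :+ (d :+ l) := con 6 :* l :+ d)
                                                      refl (suc ℓ) (s k x2 ∸ s k x1) ⟩
    6 * suc ℓ + (s k x2 ∸ s k x1)            ∎
    where
    open ≤-Reasoning
    open +-*-Solver

cost-arithmetic : ∀ K A k sc πN ν L N D → L ≤ K * ν → sc * ν ≤ A * N → πN * ν ≤ 5 * N → ν ≤ N →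
                  (sc + πN * k + (6 * suc πN + D)) * L ≤ suc (K * (A + 5 * k + 36)) * (N + D * L)
cost-arithmetic K A k sc πN ν L N D L≤Kν scν≤AN πNν≤5N ν≤N = begin
  (sc + πN * k + (6 * suc πN + D)) * L
    ≡⟨ solve 5 (λ sc πN k D L → (sc :+ πN :* k :+ (con 6 :* (con 1 :+ πN) :+ D)) :* L
                              := sc :* L :+ k :* (πN :* L) :+ con 6 :* (L :+ πN :* L) :+ D :* L) refl sc πN k D L ⟩
  sc * L + k * (πN * L) + 6 * (L + πN * L) + D * L
    ≤⟨ +-monoˡ-≤ (D * L) (+-mono-≤ (+-mono-≤ (scaled {sc} scν≤AN) (*-monoʳ-≤ k (scaled {πN} πNν≤5N)))
                                     (*-monoʳ-≤ 6 (+-mono-≤ (≤-trans L≤Kν (*-monoʳ-≤ K ν≤N)) (scaled {πN} πNν≤5N)))) ⟩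
  K * (A * N) + k * (K * (5 * N)) + 6 * (K * N + K * (5 * N)) + D * L
    ≡⟨ solve 6 (λ K A k N D L → K :* (A :* N) :+ k :* (K :* (con 5 :* N))
                                  :+ con 6 :* (K :* N :+ K :* (con 5 :* N)) :+ D :* L
                              := K :* (A :+ con 5 :* k :+ con 36) :* N :+ D :* L) refl K A k N D L ⟩
  K * (A + 5 * k + 36) * N + D * L
    ≤⟨ m≤m+n (K * (A + 5 * k + 36) * N + D * L) (N + K * (A + 5 * k + 36) * (D * L)) ⟩
  K * (A + 5 * k + 36) * N + D * L + (N + K * (A + 5 * k + 36) * (D * L))
    ≡⟨ solve 3 (λ c N e → c :* N :+ e :+ (N :+ c :* e) := (con 1 :+ c) :* (N :+ e))
               refl (K * (A + 5 * k + 36)) N (D * L) ⟩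
  suc (K * (A + 5 * k + 36)) * (N + D * L) ∎
  where
  open ≤-Reasoning
  open +-*-Solver
  scaled : ∀ {m M} → m * ν ≤ M → m * L ≤ K * M
  scaled {m} {M} mν≤M = begin
    m * L          ≤⟨ *-monoʳ-≤ m L≤Kν ⟩
    m * (K * ν)    ≡⟨ solve 3 (λ m K ν → m :* (K :* ν) := K :* (m :* ν)) refl m K ν ⟩
    K * (m * ν)    ≤⟨ *-monoʳ-≤ K mν≤M ⟩
    K * M          ∎

totalCost*loglog≤ : ∀ {k} → 1 ≤ k → ∀ sieveCost {A} x x1 x2 → x1 ≤ x2 → x2 ≤ x → 4 ≤ iroot k x →
                    sieveCost (iroot k x) * loglog (iroot k x) ≤ A * iroot k x →
                    totalCost sieveCost k x x1 x2 * loglog x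
                      ≤ suc ((2 + k) * (A + 5 * k + 36)) * (iroot k x + (s k x2 ∸ s k x1) * loglog x)
totalCost*loglog≤ {k} k≥1 sieveCost {A} x x1 x2 x1≤x2 x2≤x 4≤N sieve = begin
  totalCost sieveCost k x x1 x2 * loglog x
    ≤⟨ *-monoˡ-≤ (loglog x) (+-monoʳ-≤ (sieveCost N + π N * k) mainCost≤6*[1+πN]+D) ⟩
  (sieveCost N + π N * k + (6 * suc (π N) + D)) * loglog x
    ≤⟨ cost-arithmetic (2 + k) A k (sieveCost N) (π N) (loglog N) (loglog x) N D
         (loglog≤[2+k]*loglog k≥1 x 4≤N) sieve (π*loglog≤ N) (≤-trans (⌊log₂⌋≤n ⌊log₂ N ⌋) (⌊log₂⌋≤n N)) ⟩
  suc ((2 + k) * (A + 5 * k + 36)) * (N + D * loglog x) ∎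
  where
  open ≤-Reasoning
  N D : ℕ
  N = iroot k x
  D = s k x2 ∸ s k x1
  mainCost≤6*[1+πN]+D : Algorithm.mainCost k x1 x2 ≤ 6 * suc (π N) + D
  mainCost≤6*[1+πN]+D = ≤-trans (mainCost≤ k≥1 x1 x2 x1≤x2)
    (+-monoˡ-≤ D (*-monoʳ-≤ 6 (s≤s (π-mono-≤ (iroot-mono-≤ k≥1 x2≤x)))))

mainTheorem3 : (k : ℕ) → 1 < k →
  -- correctness
  ((x1 x2 : ℕ) → x1 < x2 →
    ((n : ℕ) → ((x1 ≤ n × n < x2 × 0 < f k n) ⇔ (n ∈ map proj₁ (Algorithm.output k x1 x2))))
    × ((b t : ℕ) → b < t → x1 ≤ S k b t → S k b t < x2 →
        (S k b t , p (b + 1)) ∈ Algorithm.output k x1 x2))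
  ×
  -- complexity: O(x^{1/k} / log log x + (s_k(x2) - s_k(x1))), given an O(N / log log N) sieve
  ((sieveCost : ℕ → ℕ) → SieveBound sieveCost →
    ∃[ C ] ∃[ X₀ ] ((x x1 x2 : ℕ) → X₀ ≤ x → x1 < x2 → x2 ≤ x →
      totalCost sieveCost k x x1 x2 * loglog x
        ≤ C * (iroot k x + (s k x2 ∸ s k x1) * loglog x)))
mainTheorem3 k 1<k =
  (λ x1 x2 _ → output-lists-gleeful k≥1 x1 x2 , output-lists-first-prime k≥1 x1 x2) ,
  λ sieveCost (A , N₀ , sieve-bound) → suc ((2 + k) * (A + 5 * k + 36)) , (N₀ + 4) ^ k ,
    λ x x1 x2 X₀≤x x1<x2 x2≤x →
      let N₀+4≤N = Equivalence.to (^≤⇔≤iroot k≥1) X₀≤x in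
      totalCost*loglog≤ k≥1 sieveCost {A} x x1 x2 (<⇒≤ x1<x2) x2≤x (≤-trans (m≤n+m 4 N₀) N₀+4≤N)
                        (sieve-bound (iroot k x) (≤-trans (m≤m+n N₀ 4) N₀+4≤N))
  where
  k≥1 : 1 ≤ k
  k≥1 = <⇒≤ 1<k
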